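{- For every $\varepsilon,\delta > 0$ there exists a constant $C = C(\varepsilon,\delta)$ such that the following holds. Let $\alpha \geqslant 0$, let $\mathcal{G}$ be a $d$-regular graph on $n$ vertices, and suppose that $2e(A) \geqslant \varepsilon |A| d$ for every $A \subseteq V(\mathcal{G})$ with $|A| \geqslant (\alpha+\delta)n$. Then $$I(\mathcal{G},m) \leqslant \binom{(\alpha+2\delta)n}{m}$$ for every $m \geqslant Cn/d$.
   Context: $e(A)$ denotes the number of edges of $\mathcal{G}$ with both endpoints in $A$, and $I(\mathcal{G},m)$ denotes the number of independent sets of size $m$ in $\mathcal{G}$.
   Formalization: The parameters ε, δ and α, together with the constant C = C(ε,δ), take only rational values. -}

module Defs where

open import Data.Bool using (Bool; true; false; _∧_; if_then_else_)
open import Data.Nat as ℕ using (ℕ; zero; suc)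
open import Data.Fin using (Fin; toℕ)
open import Data.List using (List; []; _∷_; map; filter; length; allFin; concatMap; foldr)
open import Data.Vec using (Vec; []; _∷_; lookup)
open import Data.Integer using (+_)
open import Data.Rational using (ℚ; 0ℚ; 1ℚ; _/_; _*_; _+_; _-_)
open import Data.Rational.Properties using (_≤?_)
open import Relation.Nullary.Decidable using (does; ⌊_⌋)
open import Relation.Binary.PropositionalEquality using (_≡_)

record Graph (n : ℕ) : Set where
  field
    adj    : Fin n → Fin n → Bool
    sym    : ∀ u v → adj u v ≡ adj v u
    irrefl : ∀ u → adj u u ≡ false
open Graph public

-- Subsets of the vertex set: characteristic vectors.
VSet : ℕ → Set
VSet n = Vec Bool n

_∈ᵇ_ : ∀ {n} → Fin n → VSet n → Bool
u ∈ᵇ A = lookup A u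

countV : ∀ {n} → (Fin n → Bool) → ℕ
countV {n} p = length (filter (λ u → p u Data.Bool.≟ true) (allFin n))
  where import Data.Bool

size : ∀ {n} → VSet n → ℕ
size A = countV (λ u → u ∈ᵇ A)

deg : ∀ {n} → Graph n → Fin n → ℕ
deg G v = countV (λ u → adj G v u)

Regular : ∀ {n} → Graph n → ℕ → Set
Regular G d = ∀ v → deg G v ≡ d

e : ∀ {n} → Graph n → VSet n → ℕ
e {n} G A = length (filter (λ p → ok p Data.Bool.≟ true) pairs)
  where
    import Data.Bool
    open import Data.Product using (_×_; _,_)
    pairs : List (Fin n × Fin n)
    pairs = concatMap (λ u → map (λ v → u , v) (allFin n)) (allFin n)
    ok : Fin n × Fin n → Bool
    ok (u , v) = ⌊ toℕ u ℕ.<? toℕ v ⌋ ∧ (u ∈ᵇ A ∧ (v ∈ᵇ A ∧ adj G u v))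

allSubsets : (n : ℕ) → List (VSet n)
allSubsets zero = [] ∷ []
allSubsets (suc n) = map (true ∷_) (allSubsets n) Data.List.++ map (false ∷_) (allSubsets n)
  where import Data.List

isIndependent : ∀ {n} → Graph n → VSet n → Bool
isIndependent {n} G A =
  allB (λ u → allB (λ v → not' (u ∈ᵇ A ∧ (v ∈ᵇ A ∧ adj G u v))) (allFin n)) (allFin n)
  where
    allB : (Fin n → Bool) → List (Fin n) → Bool
    allB f = foldr (λ x b → f x ∧ b) true
    not' : Bool → Bool
    not' true = false
    not' false = true

I : ∀ {n} → Graph n → ℕ → ℕ
I {n} G m = length (filter (λ A → (⌊ size A ℕ.≟ m ⌋ ∧ isIndependent G A) Data.Bool.≟ true) (allSubsets n))
  where import Data.Bool

ℕ→ℚ : ℕ → ℚ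
ℕ→ℚ k = (+ k) / 1

binomPoly : ℚ → ℕ → ℚ
binomPoly x zero = 1ℚ
binomPoly x (suc m) = binomPoly x m * ((x - ℕ→ℚ m) * ((+ 1) / suc m))

-- generalized binomial coefficient for rational top: the polynomial when
-- x ≥ m - 1 (all factors nonnegative), and 0 otherwise.
binomℚ : ℚ → ℕ → ℚ
binomℚ x m = if does (ℕ→ℚ m ≤? (x + 1ℚ)) then binomPoly x m else 0ℚ

module Submission where

-- Write I(B,m) for the number of independent m-subsets of a vertex set B.
-- Splitting on whether a vertex v ∈ B is used gives the peeling recursion
--   I(B,m) ≤ I(B∖v, m) + I(B∖N[v], m-1),
-- which alone yields I(B,m) ≤ C(|B|,m).  Let b be (α+δ)n rounded down and
-- q = ⌊d/a⌋ ≤ εd (a the denominator of ε).  Every B with |B| > b has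
-- 2e(B) ≥ q|B|, hence a vertex of degree ≥ q inside B; peeling there, the
-- second branch loses q+1 vertices.  After K = ⌊n/(q+1)⌋+1 such branches
-- the set has at most b vertices, so I(V,m) ≤ Σ_{k≤K} C(n,k)·C(b,m-k).
-- With t = ⌊n/c⌋ ≤ δn (c the denominator of δ) and m·d ≥ 1536ac²·n, each
-- term is at most C(t,2k)·C(b,m-2k), and Vandermonde's inequality bounds
-- the sum by C(b+t,m), where b + t ≤ (α+2δ)n.

open import Data.Nat using (ℕ)

module Counting where

  open import Data.Bool using (Bool; true; false; not; _∧_)
  import Data.Bool as Bool
  open import Data.Bool.Properties using (¬-not)
  open import Data.Nat using (ℕ; zero; suc; _+_; _≤_; _<_; z≤n; s≤s)
  open import Data.Nat.Properties
  open import Data.Fin using (Fin) renaming (zero to fz; suc to fs)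
  open import Data.Fin.Properties using (any?)
  open import Data.List using (List; []; _∷_; map; filter; length; concatMap; tabulate; _++_)
  open import Data.Vec using ([]; _∷_; lookup)
  open import Data.Product using (∃; _,_)
  open import Data.Empty using (⊥-elim)
  open import Function using (_∘_; id)
  open import Relation.Nullary using (yes; no)
  open import Relation.Binary.PropositionalEquality
  open import Algebra.Properties.Semiring.Sum +-*-semiring using (sum; sum-syntax; sum-cong-≗; sum-replicate-zero)
  open import Defs hiding (sym)

  bit : Bool → ℕ
  bit true = 1
  bit false = 0

  bit≤1 : ∀ b → bit b ≤ 1
  bit≤1 true = s≤s z≤n
  bit≤1 false = z≤n

  bit-mono : ∀ {a b} → (a ≡ true → b ≡ true) → bit a ≤ bit b
  bit-mono {false} h = z≤n
  bit-mono {true} h rewrite h refl = ≤-refl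

  countL : ∀ {A : Set} → (A → Bool) → List A → ℕ
  countL h xs = length (filter (λ x → h x Bool.≟ true) xs)

  countL-∷ : ∀ {A : Set} (h : A → Bool) x xs → countL h (x ∷ xs) ≡ bit (h x) + countL h xs
  countL-∷ h x xs with h x
  ... | true = refl
  ... | false = refl

  countL-++ : ∀ {A : Set} (h : A → Bool) xs ys → countL h (xs ++ ys) ≡ countL h xs + countL h ys
  countL-++ h [] ys = refl
  countL-++ h (x ∷ xs) ys = begin
    countL h (x ∷ xs ++ ys)                  ≡⟨ countL-∷ h x (xs ++ ys) ⟩
    bit (h x) + countL h (xs ++ ys)          ≡⟨ cong (bit (h x) +_) (countL-++ h xs ys) ⟩
    bit (h x) + (countL h xs + countL h ys)  ≡⟨ sym (+-assoc (bit (h x)) _ _) ⟩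
    bit (h x) + countL h xs + countL h ys    ≡⟨ cong (_+ countL h ys) (sym (countL-∷ h x xs)) ⟩
    countL h (x ∷ xs) + countL h ys          ∎
    where open ≡-Reasoning

  countL-map : ∀ {A C : Set} (h : C → Bool) (f : A → C) xs → countL h (map f xs) ≡ countL (h ∘ f) xs
  countL-map h f [] = refl
  countL-map h f (x ∷ xs) = trans (countL-∷ h (f x) (map f xs))
    (trans (cong (bit (h (f x)) +_) (countL-map h f xs)) (sym (countL-∷ (h ∘ f) x xs)))

  countF : ∀ {n} → (Fin n → Bool) → ℕ
  countF p = sum (bit ∘ p)

  countL-tabulate : ∀ {A : Set} {n} (h : A → Bool) (f : Fin n → A) → countL h (tabulate f) ≡ countF (h ∘ f)
  countL-tabulate {n = zero} h f = refl
  countL-tabulate {n = suc n} h f =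
    trans (countL-∷ h (f fz) _) (cong (bit (h (f fz)) +_) (countL-tabulate h (f ∘ fs)))

  countV≡countF : ∀ {n} (p : Fin n → Bool) → countV p ≡ countF p
  countV≡countF p = countL-tabulate p id

  size≡countF : ∀ {n} (A : VSet n) → size A ≡ countF (lookup A)
  size≡countF A = countV≡countF (lookup A)

  countL-concatMap : ∀ {A C : Set} {n} (h : C → Bool) (g : A → List C) (f : Fin n → A) →
    countL h (concatMap g (tabulate f)) ≡ ∑[ i < n ] countL h (g (f i))
  countL-concatMap {n = zero} h g f = refl
  countL-concatMap {n = suc n} h g f =
    trans (countL-++ h (g (f fz)) _) (cong (countL h (g (f fz)) +_) (countL-concatMap h g (f ∘ fs)))

  sum-mono : ∀ {n} {f g : Fin n → ℕ} → (∀ i → f i ≤ g i) → sum f ≤ sum g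
  sum-mono {zero} le = z≤n
  sum-mono {suc n} le = +-mono-≤ (le fz) (sum-mono (le ∘ fs))

  countF≤n : ∀ {n} (p : Fin n → Bool) → countF p ≤ n
  countF≤n {zero} p = z≤n
  countF≤n {suc n} p = +-mono-≤ (bit≤1 (p fz)) (countF≤n (p ∘ fs))

  size≤n : ∀ {n} (A : VSet n) → size A ≤ n
  size≤n A = ≤-trans (≤-reflexive (size≡countF A)) (countF≤n (lookup A))

  countF-none : ∀ {n} (p : Fin n → Bool) → (∀ v → p v ≡ false) → countF p ≡ 0
  countF-none {n} p none = trans (sum-cong-≗ (λ v → cong bit (none v))) (sum-replicate-zero n)

  countF-pos : ∀ {n} (p : Fin n → Bool) → 0 < countF p → ∃ λ v → p v ≡ true
  countF-pos p pos with any? (λ v → p v Bool.≟ true)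
  ... | yes witness = witness
  ... | no none = ⊥-elim (<-irrefl (sym (countF-none p λ v → ¬-not λ pv → none (v , pv))) pos)

  sumS : ∀ {n} → (VSet n → ℕ) → ℕ
  sumS {zero} f = f []
  sumS {suc n} f = sumS (λ A → f (true ∷ A)) + sumS (λ A → f (false ∷ A))

  countS : ∀ {n} → (VSet n → Bool) → ℕ
  countS P = sumS (bit ∘ P)

  countL-allSubsets : ∀ {n} (P : VSet n → Bool) → countL P (allSubsets n) ≡ countS P
  countL-allSubsets {zero} P = trans (countL-∷ P [] []) (+-identityʳ _)
  countL-allSubsets {suc n} P = trans (countL-++ P (map (true ∷_) (allSubsets n)) _)
    (cong₂ _+_ (trans (countL-map P (true ∷_) (allSubsets n)) (countL-allSubsets (λ A → P (true ∷ A))))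
               (trans (countL-map P (false ∷_) (allSubsets n)) (countL-allSubsets (λ A → P (false ∷ A)))))

  sumS-mono : ∀ {n} {f g : VSet n → ℕ} → (∀ A → f A ≤ g A) → sumS f ≤ sumS g
  sumS-mono {zero} le = le []
  sumS-mono {suc n} le = +-mono-≤ (sumS-mono (λ A → le (true ∷ A))) (sumS-mono (λ A → le (false ∷ A)))

  sumS-+ : ∀ {n} (f g : VSet n → ℕ) → sumS (λ A → f A + g A) ≡ sumS f + sumS g
  sumS-+ {zero} f g = refl
  sumS-+ {suc n} f g = begin
    sumS (λ A → f (true ∷ A) + g (true ∷ A)) + sumS (λ A → f (false ∷ A) + g (false ∷ A))
      ≡⟨ cong₂ _+_ (sumS-+ (λ A → f (true ∷ A)) (λ A → g (true ∷ A)))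
                   (sumS-+ (λ A → f (false ∷ A)) (λ A → g (false ∷ A))) ⟩
    (ft + gt) + (ff + gf)
      ≡⟨ +-assoc ft gt (ff + gf) ⟩
    ft + (gt + (ff + gf))
      ≡⟨ cong (ft +_) (trans (sym (+-assoc gt ff gf)) (trans (cong (_+ gf) (+-comm gt ff)) (+-assoc ff gt gf))) ⟩
    ft + (ff + (gt + gf))
      ≡⟨ sym (+-assoc ft ff (gt + gf)) ⟩
    (ft + ff) + (gt + gf) ∎
    where
    open ≡-Reasoning
    ft ff gt gf : ℕ
    ft = sumS (λ A → f (true ∷ A))
    ff = sumS (λ A → f (false ∷ A))
    gt = sumS (λ A → g (true ∷ A))
    gf = sumS (λ A → g (false ∷ A))

  sumS-zero : ∀ {n} → sumS {n} (λ _ → 0) ≡ 0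
  sumS-zero {zero} = refl
  sumS-zero {suc n} = cong₂ _+_ (sumS-zero {n}) (sumS-zero {n})

  -- Toggling membership of one point permutes the subsets, so it preserves sums.
  flipAt : ∀ {n} → Fin n → VSet n → VSet n
  flipAt fz (x ∷ xs) = not x ∷ xs
  flipAt (fs i) (x ∷ xs) = x ∷ flipAt i xs

  sumS-flip : ∀ {n} (v : Fin n) (f : VSet n → ℕ) → sumS (λ A → f (flipAt v A)) ≡ sumS f
  sumS-flip fz f = +-comm (sumS (λ A → f (false ∷ A))) (sumS (λ A → f (true ∷ A)))
  sumS-flip (fs v) f = cong₂ _+_ (sumS-flip v (λ A → f (true ∷ A))) (sumS-flip v (λ A → f (false ∷ A)))

  lookup-flip-same : ∀ {n} (v : Fin n) A → lookup (flipAt v A) v ≡ not (lookup A v)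
  lookup-flip-same fz (x ∷ A) = refl
  lookup-flip-same (fs v) (x ∷ A) = lookup-flip-same v A

  lookup-flip-other : ∀ {n} (v u : Fin n) A → u ≢ v → lookup (flipAt v A) u ≡ lookup A u
  lookup-flip-other fz fz A u≢v = ⊥-elim (u≢v refl)
  lookup-flip-other fz (fs u) (x ∷ A) u≢v = refl
  lookup-flip-other (fs v) fz (x ∷ A) u≢v = refl
  lookup-flip-other (fs v) (fs u) (x ∷ A) u≢v = lookup-flip-other v u A (u≢v ∘ cong fs)

  size-flip : ∀ {n} (v : Fin n) (A : VSet n) → lookup A v ≡ false → size (flipAt v A) ≡ suc (size A)
  size-flip v A v∉A = trans (size≡countF (flipAt v A)) (trans (go v A v∉A) (cong suc (sym (size≡countF A))))
    where
    go : ∀ {n} (v : Fin n) (A : VSet n) → lookup A v ≡ false → countF (lookup (flipAt v A)) ≡ suc (countF (lookup A))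
    go fz (false ∷ A) v∉A = refl
    go (fs v) (x ∷ A) v∉A = trans (cong (bit x +_) (go v A v∉A)) (+-suc (bit x) _)

  isEmpty : ∀ {n} → VSet n → Bool
  isEmpty [] = true
  isEmpty (x ∷ xs) = not x ∧ isEmpty xs

  countS-isEmpty : ∀ {n} → countS {n} isEmpty ≡ 1
  countS-isEmpty {zero} = refl
  countS-isEmpty {suc n} = cong₂ _+_ (sumS-zero {n}) (countS-isEmpty {n})

  isEmpty-lookup : ∀ {n} (A : VSet n) → (∀ u → lookup A u ≡ false) → isEmpty A ≡ true
  isEmpty-lookup [] none = refl
  isEmpty-lookup (x ∷ A) none rewrite none fz = isEmpty-lookup A (none ∘ fs)

module Graphs where

  open import Data.Bool using (Bool; true; false; not; _∧_)
  import Data.Bool as Bool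
  open import Data.Nat using (ℕ; zero; suc; _+_; _*_; _≤_; _<_; z≤n; _<?_; _≤?_)
  open import Data.Nat.Properties
  open import Data.Fin using (Fin; toℕ) renaming (zero to fz; suc to fs)
  open import Data.Fin.Properties using (any?)
  open import Data.List using (map; foldr; tabulate; allFin)
  open import Data.Vec using (lookup)
  open import Data.Product using (∃; _×_; _,_)
  open import Data.Empty using (⊥-elim)
  open import Function using (_∘_; id)
  open import Relation.Nullary using (yes; no; _×-dec_)
  open import Relation.Nullary.Decidable using (⌊_⌋)
  open import Relation.Binary.PropositionalEquality
  open import Algebra.Properties.Semiring.Sum +-*-semiring
    using (sum; sum-syntax; sum-cong-≗; sum-replicate-zero; ∑-distrib-+; ∑-comm; *-distribˡ-sum)
  open import Defs hiding (sym)
  open Counting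

  all-tabulate⇒ : ∀ {n} {X : Set} (g : Fin n → X) (f : X → Bool) →
    foldr (λ x b → f x ∧ b) true (tabulate g) ≡ true → ∀ i → f (g i) ≡ true
  all-tabulate⇒ {suc n} g f h i with f (g fz) in g₀
  all-tabulate⇒ {suc n} g f h fz | true = g₀
  all-tabulate⇒ {suc n} g f h (fs i) | true = all-tabulate⇒ (g ∘ fs) f h i

  all-tabulate⇐ : ∀ {n} {X : Set} (g : Fin n → X) (f : X → Bool) →
    (∀ i → f (g i) ≡ true) → foldr (λ x b → f x ∧ b) true (tabulate g) ≡ true
  all-tabulate⇐ {zero} g f h = refl
  all-tabulate⇐ {suc n} g f h rewrite h fz = all-tabulate⇐ (g ∘ fs) f (h ∘ fs)

  allᵇ : ∀ {n} → (Fin n → Bool) → Bool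
  allᵇ {n} f = foldr (λ u b → f u ∧ b) true (allFin n)

  allᵇ⇒ : ∀ {n} (f : Fin n → Bool) → allᵇ f ≡ true → ∀ u → f u ≡ true
  allᵇ⇒ = all-tabulate⇒ id

  allᵇ⇐ : ∀ {n} (f : Fin n → Bool) → (∀ u → f u ≡ true) → allᵇ f ≡ true
  allᵇ⇐ = all-tabulate⇐ id

  Indep : ∀ {n} → Graph n → VSet n → Set
  Indep G A = ∀ u v → lookup A u ≡ true → lookup A v ≡ true → adj G u v ≡ false

  isIndependent⇒Indep : ∀ {n} (G : Graph n) (A : VSet n) → isIndependent G A ≡ true → Indep G A
  isIndependent⇒Indep {n} G A h u v u∈A v∈A
    with all-tabulate⇒ id _ (all-tabulate⇒ id (λ u → foldr _ true (allFin n)) h u) v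
  ... | uv rewrite u∈A | v∈A with adj G u v
  ... | false = refl

  independent? : ∀ {n} → Graph n → VSet n → Bool
  independent? G A = allᵇ (λ u → allᵇ (λ v → not (lookup A u ∧ (lookup A v ∧ adj G u v))))

  independent?⇒ : ∀ {n} (G : Graph n) (A : VSet n) → independent? G A ≡ true → Indep G A
  independent?⇒ G A h u v u∈A v∈A with allᵇ⇒ _ (allᵇ⇒ _ h u) v
  ... | uv rewrite u∈A | v∈A with adj G u v
  ... | false = refl

  independent?⇐ : ∀ {n} (G : Graph n) (A : VSet n) → Indep G A → independent? G A ≡ true
  independent?⇐ G A ind = allᵇ⇐ _ (λ u → allᵇ⇐ _ (λ v → noEdge u v))
    where
    noEdge : ∀ u v → not (lookup A u ∧ (lookup A v ∧ adj G u v)) ≡ true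
    noEdge u v with lookup A u in u∈A | lookup A v in v∈A
    ... | false | _ = refl
    ... | true | false = refl
    ... | true | true rewrite ind u v u∈A v∈A = refl

  bit-∧ : ∀ a b → bit (a ∧ b) ≡ bit a * bit b
  bit-∧ false b = refl
  bit-∧ true b = sym (+-identityʳ (bit b))

  edgeTerm : ∀ {n} → Graph n → VSet n → Fin n → Fin n → ℕ
  edgeTerm G A u v = bit (⌊ toℕ u <? toℕ v ⌋ ∧ (lookup A u ∧ (lookup A v ∧ adj G u v)))

  e≡∑edgeTerm : ∀ {n} (G : Graph n) (A : VSet n) → e G A ≡ ∑[ u < n ] ∑[ v < n ] edgeTerm G A u v
  e≡∑edgeTerm {n} G A =
    trans (countL-concatMap {n = n} isEdge (λ u → map (λ v → u , v) (allFin n)) id)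
      (sum-cong-≗ (λ u → trans (countL-map isEdge (λ v → u , v) (allFin n))
                               (countL-tabulate (λ v → isEdge (u , v)) id)))
    where
    isEdge : Fin n × Fin n → Bool
    isEdge (u , v) = ⌊ toℕ u <? toℕ v ⌋ ∧ (lookup A u ∧ (lookup A v ∧ adj G u v))

  Indep⇒e≡0 : ∀ {n} (G : Graph n) (A : VSet n) → Indep G A → e G A ≡ 0
  Indep⇒e≡0 {n} G A ind =
    trans (e≡∑edgeTerm G A)
      (trans (sum-cong-≗ (λ u → trans (sum-cong-≗ (edgeTerm≡0 u)) (sum-replicate-zero n)))
             (sum-replicate-zero n))
    where
    bit-∧false : ∀ c → bit (c ∧ false) ≡ 0
    bit-∧false false = refl
    bit-∧false true = refl
    edgeTerm≡0 : ∀ u v → edgeTerm G A u v ≡ 0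
    edgeTerm≡0 u v with lookup A u in u∈A | lookup A v in v∈A
    ... | false | _ = bit-∧false (⌊ toℕ u <? toℕ v ⌋)
    ... | true | false = bit-∧false (⌊ toℕ u <? toℕ v ⌋)
    ... | true | true rewrite ind u v u∈A v∈A = bit-∧false (⌊ toℕ u <? toℕ v ⌋)

  degIn : ∀ {n} → Graph n → VSet n → Fin n → ℕ
  degIn G A v = countF (λ u → lookup A u ∧ adj G v u)

  -- Each edge uv inside A is counted once at u and once at v.
  edgeTerm-pair : ∀ {n} (G : Graph n) (A : VSet n) u v →
    edgeTerm G A u v + edgeTerm G A v u ≤ bit (lookup A u ∧ (lookup A v ∧ adj G u v))
  edgeTerm-pair G A u v rewrite Graph.sym G v u with toℕ u <? toℕ v | toℕ v <? toℕ u
  ... | yes u<v | yes v<u = ⊥-elim (<-asym u<v v<u)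
  ... | yes _ | no _ = ≤-reflexive (+-identityʳ _)
  ... | no _ | yes _ = ≤-reflexive (swap∧ (lookup A u) (lookup A v) (adj G u v))
    where
    swap∧ : ∀ a b c → bit (b ∧ (a ∧ c)) ≡ bit (a ∧ (b ∧ c))
    swap∧ false false c = refl
    swap∧ false true c = refl
    swap∧ true false c = refl
    swap∧ true true c = refl
  ... | no _ | no _ = z≤n

  handshake : ∀ {n} (G : Graph n) (A : VSet n) →
    2 * e G A ≤ ∑[ u < n ] (bit (lookup A u) * degIn G A u)
  handshake {n} G A = begin
    2 * e G A
      ≡⟨ cong (2 *_) (e≡∑edgeTerm G A) ⟩
    S + (S + 0)
      ≡⟨ cong (S +_) (trans (+-identityʳ S) (∑-comm (edgeTerm G A))) ⟩
    S + ∑[ u < n ] ∑[ v < n ] edgeTerm G A v u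
      ≡⟨ sym (∑-distrib-+ (λ u → ∑[ v < n ] edgeTerm G A u v) (λ u → ∑[ v < n ] edgeTerm G A v u)) ⟩
    ∑[ u < n ] (∑[ v < n ] edgeTerm G A u v + ∑[ v < n ] edgeTerm G A v u)
      ≡⟨ sum-cong-≗ (λ u → sym (∑-distrib-+ (edgeTerm G A u) (λ v → edgeTerm G A v u))) ⟩
    ∑[ u < n ] ∑[ v < n ] (edgeTerm G A u v + edgeTerm G A v u)
      ≤⟨ sum-mono (λ u → sum-mono (edgeTerm-pair G A u)) ⟩
    ∑[ u < n ] ∑[ v < n ] bit (lookup A u ∧ (lookup A v ∧ adj G u v))
      ≡⟨ sum-cong-≗ (λ u → trans (sum-cong-≗ (λ v → bit-∧ (lookup A u) (lookup A v ∧ adj G u v)))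
                                  (sym (*-distribˡ-sum (bit (lookup A u)) (λ v → bit (lookup A v ∧ adj G u v))))) ⟩
    ∑[ u < n ] (bit (lookup A u) * degIn G A u) ∎
    where
    open ≤-Reasoning
    S : ℕ
    S = ∑[ u < n ] ∑[ v < n ] edgeTerm G A u v

  highDegreeVertex : ∀ {n} (G : Graph n) (A : VSet n) (q : ℕ) → q * size A ≤ 2 * e G A → 0 < size A →
    ∃ λ v → lookup A v ≡ true × q ≤ degIn G A v
  highDegreeVertex {n} G A q dense nonempty
    with any? (λ v → (lookup A v Bool.≟ true) ×-dec (q ≤? degIn G A v))
  ... | yes found = found
  ... | no none = ⊥-elim (<-irrefl (sym size≡0) nonempty)
    where
    Sd : ℕ
    Sd = ∑[ u < n ] (bit (lookup A u) * degIn G A u)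
    lowDegree : ∀ v → bit (lookup A v) * suc (degIn G A v) ≤ bit (lookup A v) * q
    lowDegree v with lookup A v in v∈A | q ≤? degIn G A v
    ... | false | _ = z≤n
    ... | true | yes high = ⊥-elim (none (v , v∈A , high))
    ... | true | no ¬high = +-mono-≤ (≰⇒> ¬high) z≤n
    size+Sd≤Sd : size A + Sd ≤ 0 + Sd
    size+Sd≤Sd = begin
      size A + Sd
        ≡⟨ cong (_+ Sd) (size≡countF A) ⟩
      countF (lookup A) + Sd
        ≡⟨ sym (∑-distrib-+ (bit ∘ lookup A) (λ u → bit (lookup A u) * degIn G A u)) ⟩
      ∑[ u < n ] (bit (lookup A u) + bit (lookup A u) * degIn G A u)
        ≡⟨ sum-cong-≗ (λ u → sym (*-suc (bit (lookup A u)) _)) ⟩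
      ∑[ u < n ] (bit (lookup A u) * suc (degIn G A u))
        ≤⟨ sum-mono lowDegree ⟩
      ∑[ u < n ] (bit (lookup A u) * q)
        ≡⟨ sum-cong-≗ (λ u → *-comm (bit (lookup A u)) q) ⟩
      ∑[ u < n ] (q * bit (lookup A u))
        ≡⟨ sym (*-distribˡ-sum q (bit ∘ lookup A)) ⟩
      q * countF (lookup A)
        ≡⟨ cong (q *_) (sym (size≡countF A)) ⟩
      q * size A
        ≤⟨ dense ⟩
      2 * e G A
        ≤⟨ handshake G A ⟩
      Sd ∎
      where open ≤-Reasoning
    size≡0 : size A ≡ 0
    size≡0 = n≤0⇒n≡0 (+-cancelʳ-≤ Sd (size A) 0 size+Sd≤Sd)

-- Binomial coefficients, defined by Pascal's rule (the recursion followed by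
-- the counting arguments below), and the identities used later.
module Binomial where

  open import Data.Nat using (ℕ; zero; suc; _+_; _*_; _≤_; _<_; z≤n; s≤s)
  open import Data.Nat.Properties
  open import Data.Nat.Tactic.RingSolver using (solve-∀)
  open import Data.Product using (_,_)
  open import Relation.Binary.PropositionalEquality

  binom : ℕ → ℕ → ℕ
  binom n zero = 1
  binom zero (suc k) = 0
  binom (suc n) (suc k) = binom n k + binom n (suc k)

  binom-suc : ∀ n k → binom n k ≤ binom (suc n) k
  binom-suc n zero = ≤-refl
  binom-suc n (suc k) = m≤n+m (binom n (suc k)) (binom n k)

  binom-mono : ∀ {n n'} k → n ≤ n' → binom n k ≤ binom n' k
  binom-mono {n} k n≤n' with m≤n⇒∃[o]m+o≡n n≤n'
  ... | o , refl = go o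
    where
    go : ∀ o → binom n k ≤ binom (n + o) k
    go zero rewrite +-identityʳ n = ≤-refl
    go (suc o) rewrite +-suc n o = ≤-trans (go o) (binom-suc (n + o) k)

  binom-zero : ∀ n k → n < k → binom n k ≡ 0
  binom-zero zero (suc k) _ = refl
  binom-zero (suc n) (suc k) (s≤s n<k) =
    cong₂ _+_ (binom-zero n k n<k) (binom-zero n (suc k) (≤-trans n<k (n≤1+n k)))

  binom-1 : ∀ n → binom n 1 ≡ n
  binom-1 zero = refl
  binom-1 (suc n) = cong suc (binom-1 n)

  absorption : ∀ N j → binom (suc N) (suc j) * suc j ≡ suc N * binom N j
  absorption zero zero = refl
  absorption zero (suc j) = refl
  absorption (suc N) zero =
    trans (*-identityʳ (binom (suc (suc N)) 1)) (trans (binom-1 (suc (suc N))) (sym (*-identityʳ (suc (suc N)))))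
  absorption (suc N) (suc j) = begin
    ((a + c) + d) * suc (suc j)                    ≡⟨ expand a c d j ⟩
    (a + c) * suc j + (a + c) + d * suc (suc j)    ≡⟨ cong₂ (λ x y → x + (a + c) + y) (absorption N j) (absorption N (suc j)) ⟩
    suc N * a + (a + c) + suc N * c                ≡⟨ collect a c N ⟩
    suc (suc N) * (a + c)                          ∎
    where
    open ≡-Reasoning
    a = binom N j
    c = binom N (suc j)
    d = binom (suc N) (suc (suc j))
    expand : ∀ a c d j → ((a + c) + d) * suc (suc j) ≡ (a + c) * suc j + (a + c) + d * suc (suc j)
    expand = solve-∀
    collect : ∀ a c N → suc N * a + (a + c) + suc N * c ≡ suc (suc N) * (a + c)
    collect = solve-∀

  binom-ratio : ∀ j r → binom (j + r) j * r ≡ binom (j + r) (suc j) * suc j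
  binom-ratio j r = +-cancelˡ-≡ (binom N j * suc j) _ _ (begin
    binom N j * suc j + binom N j * r                ≡⟨ factor (binom N j) j r ⟩
    binom N j * suc N                                ≡⟨ *-comm (binom N j) (suc N) ⟩
    suc N * binom N j                                ≡⟨ sym (absorption N j) ⟩
    binom (suc N) (suc j) * suc j                    ≡⟨ factor' (binom N (suc j)) (binom N j) j ⟩
    binom N j * suc j + binom N (suc j) * suc j      ∎)
    where
    open ≡-Reasoning
    N : ℕ
    N = j + r
    factor : ∀ x j r → x * suc j + x * r ≡ x * suc (j + r)
    factor = solve-∀
    factor' : ∀ x y j → (y + x) * suc j ≡ y * suc j + x * suc j
    factor' = solve-∀

  binom-step≤ : ∀ n k → binom n (suc k) * suc k ≤ binom n k * n
  binom-step≤ zero k = z≤n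
  binom-step≤ (suc N) k = begin
    binom (suc N) (suc k) * suc k   ≡⟨ absorption N k ⟩
    suc N * binom N k               ≤⟨ *-monoʳ-≤ (suc N) (binom-suc N k) ⟩
    suc N * binom (suc N) k         ≡⟨ *-comm (suc N) (binom (suc N) k) ⟩
    binom (suc N) k * suc N         ∎
    where open ≤-Reasoning


  -- Doubling, with the recursion used by the termwise comparison.
  dbl : ℕ → ℕ
  dbl zero = 0
  dbl (suc k) = suc (suc (dbl k))

  dbl≡ : ∀ k → dbl k ≡ 2 * k
  dbl≡ zero = refl
  dbl≡ (suc k) = trans (cong (λ x → suc (suc x)) (dbl≡ k)) (e k)
    where e : ∀ k → suc (suc (2 * k)) ≡ 2 * suc k
          e = solve-∀

  binom-double : ∀ k r → binom (dbl k + suc (suc r)) (dbl k) * suc (suc r) * suc r ≡ binom (dbl k + suc (suc r)) (suc (suc (dbl k))) * suc (suc (dbl k)) * suc (dbl k)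
  binom-double k r = begin
    c0 * suc (suc r) * suc r ≡⟨ cong (_* suc r) (binom-ratio (dbl k) (suc (suc r))) ⟩
    c1 * suc (dbl k) * suc r ≡⟨ *-assoc c1 (suc (dbl k)) (suc r) ⟩
    c1 * (suc (dbl k) * suc r) ≡⟨ cong (c1 *_) (*-comm (suc (dbl k)) (suc r)) ⟩
    c1 * (suc r * suc (dbl k)) ≡⟨ sym (*-assoc c1 (suc r) (suc (dbl k))) ⟩
    c1 * suc r * suc (dbl k) ≡⟨ cong (_* suc (dbl k)) step2 ⟩
    c2 * suc (suc (dbl k)) * suc (dbl k) ∎
    where
    open ≡-Reasoning
    X c0 c1 c2 : ℕ
    X = dbl k + suc (suc r)
    c0 = binom X (dbl k)
    c1 = binom X (suc (dbl k))
    c2 = binom X (suc (suc (dbl k)))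
    eX : X ≡ suc (dbl k) + suc r
    eX = +-suc (dbl k) (suc r)
    step2 : c1 * suc r ≡ c2 * suc (suc (dbl k))
    step2 = trans (cong (λ y → binom y (suc (dbl k)) * suc r) eX) (trans (binom-ratio (suc (dbl k)) (suc r)) (cong (λ y → binom y (suc (suc (dbl k))) * suc (suc (dbl k))) (sym eX)))

module Peeling where

  open import Data.Bool using (Bool; true; false; not; _∧_; _∨_)
  open import Data.Bool.Properties using (not-injective)
  open import Data.Nat using (ℕ; zero; suc; _+_; _≤_; _<_; z≤n; s≤s; _≟_)
  open import Data.Nat.Properties
  open import Data.Fin using (Fin) renaming (zero to fz; suc to fs)
  import Data.Fin as Fin
  open import Data.Vec using (lookup; tabulate)
  open import Data.Vec.Properties using (lookup∘tabulate)
  open import Data.Product using (_×_; _,_; proj₁)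
  open import Data.Empty using (⊥; ⊥-elim)
  open import Function using (_∘_)
  open import Relation.Nullary using (Dec; yes; no)
  open import Relation.Nullary.Decidable using (⌊_⌋; does; dec-false)
  open import Relation.Binary.PropositionalEquality
  open import Algebra.Properties.Semiring.Sum +-*-semiring using (sum-syntax; ∑-distrib-+)
  open import Defs hiding (sym)
  open Counting
  open Graphs
  open Binomial

  ∧-true⁻ : ∀ {a b} → a ∧ b ≡ true → (a ≡ true) × (b ≡ true)
  ∧-true⁻ {true} {true} refl = refl , refl

  ∧-true⁺ : ∀ {a b} → a ≡ true → b ≡ true → a ∧ b ≡ true
  ∧-true⁺ refl refl = refl

  ⌊⌋⇒ : ∀ {P : Set} (p? : Dec P) → ⌊ p? ⌋ ≡ true → P
  ⌊⌋⇒ (yes p) _ = p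

  ⌊⌋⇐ : ∀ {P : Set} (p? : Dec P) → P → ⌊ p? ⌋ ≡ true
  ⌊⌋⇐ (yes _) _ = refl
  ⌊⌋⇐ (no ¬p) p = ⊥-elim (¬p p)

  bit-none : ∀ {a} → (a ≡ true → ⊥) → bit a ≤ 0
  bit-none {false} _ = z≤n
  bit-none {true} h = ⊥-elim (h refl)

  _⊆_ : ∀ {n} → VSet n → VSet n → Set
  A ⊆ B = ∀ u → lookup A u ≡ true → lookup B u ≡ true

  subset? : ∀ {n} → VSet n → VSet n → Bool
  subset? A B = allᵇ (λ u → not (lookup A u) ∨ lookup B u)

  subset?⇒ : ∀ {n} (A B : VSet n) → subset? A B ≡ true → A ⊆ B
  subset?⇒ A B h u u∈A with allᵇ⇒ _ h u
  ... | uAB rewrite u∈A = uAB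

  subset?⇐ : ∀ {n} (A B : VSet n) → A ⊆ B → subset? A B ≡ true
  subset?⇐ A B A⊆B = allᵇ⇐ _ pointwise
    where
    pointwise : ∀ u → not (lookup A u) ∨ lookup B u ≡ true
    pointwise u with lookup A u in u∈A
    ... | false = refl
    ... | true = A⊆B u u∈A

  IndepSubset : ∀ {n} → Graph n → VSet n → ℕ → VSet n → Set
  IndepSubset G B m A = (size A ≡ m) × (Indep G A × A ⊆ B)

  indepSubset? : ∀ {n} → Graph n → VSet n → ℕ → VSet n → Bool
  indepSubset? G B m A = ⌊ size A ≟ m ⌋ ∧ (independent? G A ∧ subset? A B)

  indepSubset?⇒ : ∀ {n} (G : Graph n) B m A → indepSubset? G B m A ≡ true → IndepSubset G B m A
  indepSubset?⇒ G B m A h with ∧-true⁻ {⌊ size A ≟ m ⌋} h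
  ... | sz , rest with ∧-true⁻ {independent? G A} rest
  ... | ind , sub = ⌊⌋⇒ (size A ≟ m) sz , independent?⇒ G A ind , subset?⇒ A B sub

  indepSubset?⇐ : ∀ {n} (G : Graph n) B m A → IndepSubset G B m A → indepSubset? G B m A ≡ true
  indepSubset?⇐ G B m A (sz , ind , sub) =
    ∧-true⁺ (⌊⌋⇐ (size A ≟ m) sz) (∧-true⁺ (independent?⇐ G A ind) (subset?⇐ A B sub))

  indepIn : ∀ {n} → Graph n → VSet n → ℕ → ℕ
  indepIn G B m = countS (indepSubset? G B m)

  indepIn-mono : ∀ {n} (G : Graph n) (B B' : VSet n) m → B ⊆ B' → indepIn G B m ≤ indepIn G B' m
  indepIn-mono G B B' m B⊆B' = sumS-mono (λ A → bit-mono (λ h →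
    let (sz , ind , A⊆B) = indepSubset?⇒ G B m A h in indepSubset?⇐ G B' m A (sz , ind , λ u → B⊆B' u ∘ A⊆B u)))

  without : ∀ {n} → VSet n → Fin n → VSet n
  without B v = tabulate (λ u → lookup B u ∧ not (does (u Fin.≟ v)))

  outsideNbhd : ∀ {n} → Graph n → VSet n → Fin n → VSet n
  outsideNbhd G B v = tabulate (λ u → lookup B u ∧ (not (does (u Fin.≟ v)) ∧ not (adj G v u)))

  outsideNbhd⊆without : ∀ {n} (G : Graph n) (B : VSet n) v → outsideNbhd G B v ⊆ without B v
  outsideNbhd⊆without G B v u h
    with ∧-true⁻ {lookup B u} (trans (sym (lookup∘tabulate _ u)) h)
  ... | u∈B , rest = trans (lookup∘tabulate _ u) (∧-true⁺ u∈B (proj₁ (∧-true⁻ rest)))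

  -- Independent sets containing v are counted by the sets in B ∖ N[v].
  nbhdCount : ∀ {n} → Graph n → VSet n → Fin n → ℕ → ℕ
  nbhdCount G B v zero = 0
  nbhdCount G B v (suc m) = indepIn G (outsideNbhd G B v) m

  module _ {n} (G : Graph n) (B : VSet n) (v : Fin n) where

    nbhdTerm : ℕ → VSet n → ℕ
    nbhdTerm zero A = 0
    nbhdTerm (suc m) A = bit (indepSubset? G (outsideNbhd G B v) m A)

    sumS-nbhdTerm : ∀ m → sumS (nbhdTerm m) ≡ nbhdCount G B v m
    sumS-nbhdTerm zero = sumS-zero {n}
    sumS-nbhdTerm (suc m) = refl

    avoid : ∀ {m} A → lookup A v ≡ false → IndepSubset G B m A → IndepSubset G (without B v) m A
    avoid A v∉A (sz , ind , A⊆B) = sz , ind , λ u u∈A →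
      trans (lookup∘tabulate _ u) (∧-true⁺ (A⊆B u u∈A) (u≢v u u∈A))
      where
      u≢v : ∀ u → lookup A u ≡ true → not (does (u Fin.≟ v)) ≡ true
      u≢v u u∈A with u Fin.≟ v
      ... | no _ = refl
      ... | yes refl with trans (sym u∈A) v∉A
      ...   | ()

    contain : ∀ {m} A → lookup A v ≡ false → IndepSubset G B m (flipAt v A) →
      (m ≡ suc (size A)) × IndepSubset G (outsideNbhd G B v) (size A) A
    contain A v∉A (sz , ind , A'⊆B) =
      trans (sym sz) (size-flip v A v∉A) , refl , indA , A⊆outside
      where
      v∈A' : lookup (flipAt v A) v ≡ true
      v∈A' = trans (lookup-flip-same v A) (cong not v∉A)
      u≢v : ∀ u → lookup A u ≡ true → u ≢ v
      u≢v u u∈A refl with trans (sym u∈A) v∉A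
      ... | ()
      A⊆A' : ∀ u → lookup A u ≡ true → lookup (flipAt v A) u ≡ true
      A⊆A' u u∈A = trans (lookup-flip-other v u A (u≢v u u∈A)) u∈A
      indA : Indep G A
      indA u w u∈A w∈A = ind u w (A⊆A' u u∈A) (A⊆A' w w∈A)
      A⊆outside : A ⊆ outsideNbhd G B v
      A⊆outside u u∈A = trans (lookup∘tabulate _ u)
        (∧-true⁺ (A'⊆B u (A⊆A' u u∈A))
          (∧-true⁺ (cong not (dec-false (u Fin.≟ v) (u≢v u u∈A))) (cong not (ind v u v∈A' (A⊆A' u u∈A)))))

    split : ∀ a c → bit a ≤ bit (a ∧ not c) + bit (a ∧ c)
    split false c = z≤n
    split true false = s≤s z≤n
    split true true = s≤s z≤n

    avoidTerm : ∀ m A → bit (indepSubset? G B m A ∧ not (lookup A v)) ≤ bit (indepSubset? G (without B v) m A)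
    avoidTerm m A = bit-mono (λ h → let (isA , v∉A) = ∧-true⁻ h in
      indepSubset?⇐ G (without B v) m A (avoid A (not-injective v∉A) (indepSubset?⇒ G B m A isA)))

    containTerm : ∀ m A → bit (indepSubset? G B m (flipAt v A) ∧ lookup (flipAt v A) v) ≤ nbhdTerm m A
    containTerm zero A = bit-none (λ h → let (isA' , v∈A') = ∧-true⁻ h in
      case (contain A (v∉A v∈A') (indepSubset?⇒ G B 0 (flipAt v A) isA')))
      where
      v∉A : lookup (flipAt v A) v ≡ true → lookup A v ≡ false
      v∉A v∈A' = not-injective (trans (sym (lookup-flip-same v A)) v∈A')
      case : ∀ {X : Set} → (0 ≡ suc (size A)) × X → ⊥
      case (() , _)
    containTerm (suc m) A = bit-mono (λ h → let (isA' , v∈A') = ∧-true⁻ h in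
      indepSubset?⇐ G (outsideNbhd G B v) m A (transport (contain A (v∉A v∈A') (indepSubset?⇒ G B (suc m) (flipAt v A) isA'))))
      where
      v∉A : lookup (flipAt v A) v ≡ true → lookup A v ≡ false
      v∉A v∈A' = not-injective (trans (sym (lookup-flip-same v A)) v∈A')
      transport : (suc m ≡ suc (size A)) × IndepSubset G (outsideNbhd G B v) (size A) A →
        IndepSubset G (outsideNbhd G B v) m A
      transport (eq , isA) rewrite suc-injective eq = isA

    peel : ∀ m → indepIn G B m ≤ indepIn G (without B v) m + nbhdCount G B v m
    peel m = begin
      sumS (λ A → bit (P A))
        ≤⟨ sumS-mono (λ A → split (P A) (lookup A v)) ⟩
      sumS (λ A → bit (P A ∧ not (lookup A v)) + bit (P A ∧ lookup A v))
        ≡⟨ sumS-+ (λ A → bit (P A ∧ not (lookup A v))) (λ A → bit (P A ∧ lookup A v)) ⟩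
      sumS (λ A → bit (P A ∧ not (lookup A v))) + sumS (λ A → bit (P A ∧ lookup A v))
        ≤⟨ +-mono-≤ (sumS-mono (avoidTerm m))
                    (≤-reflexive (sym (sumS-flip v (λ A → bit (P A ∧ lookup A v))))) ⟩
      indepIn G (without B v) m + sumS (λ A → bit (P (flipAt v A) ∧ lookup (flipAt v A) v))
        ≤⟨ +-monoʳ-≤ (indepIn G (without B v) m) (sumS-mono (containTerm m)) ⟩
      indepIn G (without B v) m + sumS (nbhdTerm m)
        ≡⟨ cong (indepIn G (without B v) m +_) (sumS-nbhdTerm m) ⟩
      indepIn G (without B v) m + nbhdCount G B v m ∎
      where
      open ≤-Reasoning
      P : VSet n → Bool
      P = indepSubset? G B m

  countF-single : ∀ {n} (v : Fin n) → countF (λ u → does (u Fin.≟ v)) ≡ 1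
  countF-single {suc n} fz = cong suc (countF-none {n} _ (λ u → refl))
  countF-single {suc n} (fs v) = countF-single {n} v

  size-without : ∀ {n} (B : VSet n) v → lookup B v ≡ true → suc (size (without B v)) ≤ size B
  size-without B v v∈B = begin
    suc (size (without B v))
      ≡⟨ cong suc (size≡countF (without B v)) ⟩
    suc (countF (lookup (without B v)))
      ≡⟨ cong (_+ countF (lookup (without B v))) (sym (countF-single v)) ⟩
    countF (λ u → does (u Fin.≟ v)) + countF (lookup (without B v))
      ≡⟨ sym (∑-distrib-+ (λ u → bit (does (u Fin.≟ v))) (λ u → bit (lookup (without B v) u))) ⟩
    ∑[ u < _ ] (bit (does (u Fin.≟ v)) + bit (lookup (without B v) u))
      ≤⟨ sum-mono pointwise ⟩
    countF (lookup B)
      ≡⟨ sym (size≡countF B) ⟩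
    size B ∎
    where
    open ≤-Reasoning
    pointwise : ∀ u → bit (does (u Fin.≟ v)) + bit (lookup (without B v) u) ≤ bit (lookup B u)
    pointwise u rewrite lookup∘tabulate (λ u → lookup B u ∧ not (does (u Fin.≟ v))) u with u Fin.≟ v
    ... | yes refl rewrite v∈B = ≤-refl
    ... | no _ with lookup B u
    ...   | true = ≤-refl
    ...   | false = ≤-refl

  size-outsideNbhd : ∀ {n} (G : Graph n) (B : VSet n) v → lookup B v ≡ true →
    suc (size (outsideNbhd G B v) + degIn G B v) ≤ size B
  size-outsideNbhd G B v v∈B = begin
    suc (size (outsideNbhd G B v) + degIn G B v)
      ≡⟨ cong (λ s → suc (s + degIn G B v)) (size≡countF (outsideNbhd G B v)) ⟩
    suc (countF (lookup (outsideNbhd G B v)) + degIn G B v)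
      ≡⟨ cong (_+ (countF (lookup (outsideNbhd G B v)) + degIn G B v)) (sym (countF-single v)) ⟩
    countF (λ u → does (u Fin.≟ v)) + (countF (lookup (outsideNbhd G B v)) + degIn G B v)
      ≡⟨ cong (countF (λ u → does (u Fin.≟ v)) +_) (sym (∑-distrib-+ (bit ∘ lookup (outsideNbhd G B v)) nbr)) ⟩
    countF (λ u → does (u Fin.≟ v)) + ∑[ u < _ ] (bit (lookup (outsideNbhd G B v) u) + nbr u)
      ≡⟨ sym (∑-distrib-+ (λ u → bit (does (u Fin.≟ v))) (λ u → bit (lookup (outsideNbhd G B v) u) + nbr u)) ⟩
    ∑[ u < _ ] (bit (does (u Fin.≟ v)) + (bit (lookup (outsideNbhd G B v) u) + nbr u))
      ≤⟨ sum-mono pointwise ⟩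
    countF (lookup B)
      ≡⟨ sym (size≡countF B) ⟩
    size B ∎
    where
    open ≤-Reasoning
    nbr : Fin _ → ℕ
    nbr u = bit (lookup B u ∧ adj G v u)
    pointwise : ∀ u → bit (does (u Fin.≟ v)) + (bit (lookup (outsideNbhd G B v) u) + nbr u) ≤ bit (lookup B u)
    pointwise u
      rewrite lookup∘tabulate (λ u → lookup B u ∧ (not (does (u Fin.≟ v)) ∧ not (adj G v u))) u
      with u Fin.≟ v
    ... | yes refl rewrite v∈B | irrefl G u = ≤-refl
    ... | no _ with lookup B u
    ...   | false = ≤-refl
    ...   | true with adj G v u
    ...     | true = ≤-refl
    ...     | false = ≤-refl

  size≡0⇒empty : ∀ {n} (B : VSet n) → size B ≡ 0 → ∀ u → lookup B u ≡ false
  size≡0⇒empty B size≡0 u with lookup B u in u∈B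
  ... | false = refl
  ... | true = ⊥-elim (<-irrefl (sym size≡0) (≤-trans (countF-point u u∈B) (≤-reflexive (sym (size≡countF B)))))
    where
    countF-point : ∀ {n} {p : Fin n → Bool} u → p u ≡ true → 1 ≤ countF p
    countF-point {p = p} fz pu rewrite pu = s≤s z≤n
    countF-point {p = p} (fs u) pu = ≤-trans (countF-point {p = p ∘ fs} u pu) (m≤n+m _ (bit (p fz)))

  indepIn-empty : ∀ {n} (G : Graph n) (B : VSet n) m → size B ≡ 0 → indepIn G B m ≤ binom 0 m
  indepIn-empty {n} G B zero size≡0 =
    ≤-trans (sumS-mono (λ A → bit-mono (λ h → isEmpty-lookup A (A-empty A (indepSubset?⇒ G B 0 A h)))))
            (≤-reflexive (countS-isEmpty {n}))
    where
    A-empty : ∀ A → IndepSubset G B 0 A → ∀ u → lookup A u ≡ false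
    A-empty A (_ , _ , A⊆B) u with lookup A u in u∈A
    ... | false = refl
    ... | true with trans (sym (A⊆B u u∈A)) (size≡0⇒empty B size≡0 u)
    ...   | ()
  indepIn-empty {n} G B (suc m) size≡0 =
    ≤-trans (sumS-mono (λ A → bit-none (λ h → noSet A (indepSubset?⇒ G B (suc m) A h)))) (≤-reflexive (sumS-zero {n}))
    where
    noSet : ∀ A → IndepSubset G B (suc m) A → ⊥
    noSet A (sz , _ , A⊆B) = 1+n≢0 (trans (sym sz) (trans (size≡countF A) (countF-none (lookup A) A-empty)))
      where
      A-empty : ∀ u → lookup A u ≡ false
      A-empty u with lookup A u in u∈A
      ... | false = refl
      ... | true with trans (sym (A⊆B u u∈A)) (size≡0⇒empty B size≡0 u)
      ...   | ()

  indepIn≤binom : ∀ {n} (G : Graph n) s (B : VSet n) m → size B ≤ s → indepIn G B m ≤ binom s m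
  indepIn≤binom G s B m |B|≤s with size B ≟ 0
  ... | yes size≡0 = ≤-trans (indepIn-empty G B m size≡0) (binom-mono m z≤n)
  indepIn≤binom G zero B m |B|≤s | no size≢0 = ⊥-elim (size≢0 (n≤0⇒n≡0 |B|≤s))
  indepIn≤binom G (suc s) B m |B|≤s | no size≢0
    with countF-pos (lookup B) (≤-trans (n≢0⇒n>0 size≢0) (≤-reflexive (size≡countF B)))
  ... | v , v∈B = ≤-trans (peel G B v m) (branches m)
    where
    |B∖v|≤s : size (without B v) ≤ s
    |B∖v|≤s = ≤-pred (≤-trans (size-without B v v∈B) |B|≤s)
    branches : ∀ m → indepIn G (without B v) m + nbhdCount G B v m ≤ binom (suc s) m
    branches zero = ≤-trans (≤-reflexive (+-identityʳ _)) (indepIn≤binom G s (without B v) 0 |B∖v|≤s)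
    branches (suc m) = ≤-trans
      (+-mono-≤ (indepIn≤binom G s (without B v) (suc m) |B∖v|≤s)
                (≤-trans (indepIn-mono G (outsideNbhd G B v) (without B v) m (outsideNbhd⊆without G B v)) (indepIn≤binom G s (without B v) m |B∖v|≤s)))
      (≤-reflexive (+-comm (binom s (suc m)) (binom s m)))

module RatioArithmetic where

  open import Data.Nat using (ℕ; suc; _+_; _*_; _≤_; s≤s)
  open import Data.Nat.Properties
  open import Data.Nat.Tactic.RingSolver using (solve-∀)
  open import Relation.Binary.PropositionalEquality
  open Binomial using (dbl; dbl≡)

  twice≤ : ∀ d r → d ≤ r → d + suc (suc r) ≤ 2 * suc r
  twice≤ d r h = ≤-trans (+-monoˡ-≤ (suc (suc r)) h) (≤-reflexive (e r))
    where e : ∀ r → r + suc (suc r) ≡ 2 * suc r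
          e = solve-∀

  twice≤′ : ∀ d r → d ≤ r → d + suc (suc r) ≤ 2 * suc (suc r)
  twice≤′ d r h = ≤-trans (twice≤ d r h) (*-monoʳ-≤ 2 (n≤1+n (suc r)))

  termwise-arith : ∀ n k D rt o →
    D + (dbl k + suc (suc o)) ≤ n → dbl k ≤ rt → dbl k ≤ o →
    64 * n * n * suc (dbl k) ≤ (dbl k + suc (suc rt)) * (dbl k + suc (suc rt)) * (dbl k + suc (suc o)) →
    (n * (dbl k + suc (suc o))) * ((suc (suc (dbl k)) * suc (dbl k)) * ((D + suc (suc (dbl k))) * (D + suc (dbl k))))
      ≤ ((suc (suc rt) * suc rt) * (suc (suc o) * suc o)) * (suc k * (D + suc k))
  termwise-arith n k D rt o hn hrt ho h64 = begin
    (n * m) * ((suc (suc d) * suc d) * ((D + suc (suc d)) * (D + suc d))) ≤⟨ *-monoʳ-≤ (n * m) (*-monoʳ-≤ (suc (suc d) * suc d) (*-mono-≤ D+d+2≤n D+d+1≤2[D+k+1])) ⟩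
    (n * m) * ((suc (suc d) * suc d) * (n * (2 * (D + suc k)))) ≡⟨ regroup ⟩
    (4 * n * n * m * suc d) * (suc k * (D + suc k)) ≤⟨ *-monoˡ-≤ (suc k * (D + suc k)) q4 ⟩
    Q' * (suc k * (D + suc k)) ∎
    where
    open ≤-Reasoning
    d m t Q' : ℕ
    d = dbl k
    m = d + suc (suc o)
    t = d + suc (suc rt)
    Q' = (suc (suc rt) * suc rt) * (suc (suc o) * suc o)
    D+d+2≤n : D + suc (suc d) ≤ n
    D+d+2≤n = ≤-trans (+-monoʳ-≤ D (≤-trans (s≤s (s≤s (m≤m+n d o))) (≤-reflexive (e d o)))) hn
      where e : ∀ d o → suc (suc (d + o)) ≡ d + suc (suc o)
            e = solve-∀
    D+d+1≤2[D+k+1] : D + suc d ≤ 2 * (D + suc k)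
    D+d+1≤2[D+k+1] = ≤-trans (m≤m+n (D + suc d) (suc D)) (≤-reflexive (e D k))
      where
      e : ∀ D k → D + suc (dbl k) + suc D ≡ 2 * (D + suc k)
      e D k rewrite dbl≡ k = e' D k
        where e' : ∀ D k → D + suc (2 * k) + suc D ≡ 2 * (D + suc k)
              e' = solve-∀
    regroup : (n * m) * ((suc (suc d) * suc d) * (n * (2 * (D + suc k)))) ≡ (4 * n * n * m * suc d) * (suc k * (D + suc k))
    regroup rewrite dbl≡ k = e n o k D
      where e : ∀ n o k D → (n * (2 * k + suc (suc o))) * ((suc (suc (2 * k)) * suc (2 * k)) * (n * (2 * (D + suc k)))) ≡ (4 * n * n * (2 * k + suc (suc o)) * suc (2 * k)) * (suc k * (D + suc k))
            e = solve-∀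
    t²≤ : t * t ≤ (2 * suc (suc rt)) * (2 * suc rt)
    t²≤ = *-mono-≤ (twice≤′ d rt hrt) (twice≤ d rt hrt)
    m²≤ : m * m ≤ (2 * suc (suc o)) * (2 * suc o)
    m²≤ = *-mono-≤ (twice≤′ d o ho) (twice≤ d o ho)
    q16 : 16 * (4 * n * n * m * suc d) ≤ 16 * Q'
    q16 = begin
      16 * (4 * n * n * m * suc d) ≡⟨ e1 n m (suc d) ⟩
      (64 * n * n * suc d) * m ≤⟨ *-monoˡ-≤ m h64 ⟩
      (t * t * m) * m ≡⟨ *-assoc (t * t) m m ⟩
      (t * t) * (m * m) ≤⟨ *-mono-≤ t²≤ m²≤ ⟩
      ((2 * suc (suc rt)) * (2 * suc rt)) * ((2 * suc (suc o)) * (2 * suc o)) ≡⟨ e2 (suc (suc rt)) (suc rt) (suc (suc o)) (suc o) ⟩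
      16 * Q' ∎
      where
      e1 : ∀ n m s → 16 * (4 * n * n * m * s) ≡ (64 * n * n * s) * m
      e1 = solve-∀
      e2 : ∀ a b c d → ((2 * a) * (2 * b)) * ((2 * c) * (2 * d)) ≡ 16 * ((a * b) * (c * d))
      e2 = solve-∀
    q4 : 4 * n * n * m * suc d ≤ Q'
    q4 = *-cancelˡ-≤ 16 q16

module Vandermonde (b : ℕ) where

  open import Data.Nat using (ℕ; zero; suc; _+_; _*_; _∸_; _≤_; z≤n; s≤s; NonZero; >-nonZero)
  open import Data.Nat.Properties
  open import Data.Nat.Tactic.RingSolver using (solve-∀)
  open import Data.Product using (Σ; _×_; _,_)
  open import Relation.Binary.PropositionalEquality
  open Binomial
  open RatioArithmetic

  -- rest m k = C(b, m-k) for k ≤ m, and 0 for k > m.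
  rest : ℕ → ℕ → ℕ
  rest m zero = binom b m
  rest zero (suc k) = 0
  rest (suc m) (suc k) = rest m k

  -- vsum x K m = Σ_{k ≤ K} C(x,k)·C(b,m-k): at most K dense peelings among x
  -- vertices, the rest of the independent set inside b vertices.
  vsum : ℕ → ℕ → ℕ → ℕ
  vsum x zero m = binom x 0 * rest m 0
  vsum x (suc K) m = vsum x K m + binom x (suc K) * rest m (suc K)

  -- vsum⁺ x K m = Σ_{k < K} C(x,k)·C(b,m-k-1), the second half of Pascal's rule.
  vsum⁺ : ℕ → ℕ → ℕ → ℕ
  vsum⁺ x zero m = 0
  vsum⁺ x (suc K) m = vsum⁺ x K m + binom x K * rest m (suc K)

  vsum-pascal : ∀ x K m → vsum (suc x) K m ≡ vsum x K m + vsum⁺ x K m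
  vsum-pascal x zero m = sym (+-identityʳ _)
  vsum-pascal x (suc K) m = begin
    vsum (suc x) K m + (binom x K + binom x (suc K)) * rest m (suc K) ≡⟨ cong₂ _+_ (vsum-pascal x K m) (*-distribʳ-+ (rest m (suc K)) (binom x K) (binom x (suc K))) ⟩
    (vsum x K m + vsum⁺ x K m) + (binom x K * rest m (suc K) + binom x (suc K) * rest m (suc K)) ≡⟨ interchange (vsum x K m) (vsum⁺ x K m) (binom x K * rest m (suc K)) (binom x (suc K) * rest m (suc K)) ⟩
    (vsum x K m + binom x (suc K) * rest m (suc K)) + (vsum⁺ x K m + binom x K * rest m (suc K)) ∎
    where
    open ≡-Reasoning
    interchange : ∀ a c d e → (a + c) + (d + e) ≡ (a + e) + (c + d)
    interchange a c d e = trans (+-assoc a c (d + e)) (trans (cong (a +_) (trans (sym (+-assoc c d e)) (+-comm (c + d) e))) (sym (+-assoc a e (c + d))))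

  vsum⁺-suc : ∀ x K m → vsum⁺ x (suc K) (suc m) ≡ vsum x K m
  vsum⁺-suc x zero m = refl
  vsum⁺-suc x (suc K) m = cong (_+ binom x (suc K) * rest m (suc K)) (vsum⁺-suc x K m)

  vsum⁺-zero : ∀ x K → vsum⁺ x K 0 ≡ 0
  vsum⁺-zero x zero = refl
  vsum⁺-zero x (suc K) = cong₂ _+_ (vsum⁺-zero x K) (*-zeroʳ (binom x K))

  vsum-mono : ∀ {x x'} K m → x ≤ x' → vsum x K m ≤ vsum x' K m
  vsum-mono zero m h = ≤-refl
  vsum-mono (suc K) m h = +-mono-≤ (vsum-mono K m h) (*-monoˡ-≤ (rest m (suc K)) (binom-mono (suc K) h))

  rest≤vsum : ∀ x K m → rest m 0 ≤ vsum x K m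
  rest≤vsum x zero m = ≤-reflexive (sym (+-identityʳ _))
  rest≤vsum x (suc K) m = ≤-trans (rest≤vsum x K m) (m≤m+n _ _)

  rest≡ : ∀ m k → k ≤ m → rest m k ≡ binom b (m ∸ k)
  rest≡ m zero h = refl
  rest≡ (suc m) (suc k) (s≤s h) = rest≡ m k h

  rest-shift : ∀ k o → rest (k + o) k ≡ binom b o
  rest-shift k o = trans (rest≡ (k + o) k (m≤m+n k o)) (cong (binom b) (m+n∸m≡n k o))

  rest-ratio≤ : ∀ D k o → D + (suc k + o) ≡ b → rest (suc k + o) (suc k) * (D + suc k) ≤ rest (suc k + o) k * (suc k + o)
  rest-ratio≤ D k o hb = begin
    rest (suc k + o) (suc k) * (D + suc k) ≡⟨ cong (_* (D + suc k)) (rest-shift (suc k) o) ⟩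
    binom b o * (D + suc k) ≡⟨ cong (λ y → binom y o * (D + suc k)) hb' ⟩
    binom (o + (D + suc k)) o * (D + suc k) ≡⟨ binom-ratio o (D + suc k) ⟩
    binom (o + (D + suc k)) (suc o) * suc o ≡⟨ cong (λ y → binom y (suc o) * suc o) (sym hb') ⟩
    binom b (suc o) * suc o ≤⟨ *-monoʳ-≤ (binom b (suc o)) (s≤s (m≤n+m o k)) ⟩
    binom b (suc o) * (suc k + o) ≡⟨ cong (λ y → y * (suc k + o)) (sym rest-k) ⟩
    rest (suc k + o) k * (suc k + o) ∎
    where
    open ≤-Reasoning
    hb' : b ≡ o + (D + suc k)
    hb' = trans (sym hb) (e D k o)
      where e : ∀ D k o → D + (suc k + o) ≡ o + (D + suc k)
            e = solve-∀
    rest-k : rest (suc k + o) k ≡ binom b (suc o)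
    rest-k = trans (cong (λ y → rest y k) (sym (+-suc k o))) (rest-shift k (suc o))

  rest-ratio≤′ : ∀ D m k → suc k ≤ m → D + m ≡ b → rest m (suc k) * (D + suc k) ≤ rest m k * m
  rest-ratio≤′ D m k h hb with m≤n⇒∃[o]m+o≡n h
  ... | o , refl = rest-ratio≤ D k o hb


  rest-double : ∀ D k o → D + (dbl k + suc (suc o)) ≡ b →
    rest (dbl k + suc (suc o)) (suc (suc (dbl k))) * (D + suc (suc (dbl k))) * (D + suc (dbl k)) ≡ rest (dbl k + suc (suc o)) (dbl k) * suc (suc o) * suc o
  rest-double D k o hb = begin
    rest m (suc (suc d)) * (D + suc (suc d)) * (D + suc d) ≡⟨ cong (λ y → y * (D + suc (suc d)) * (D + suc d)) e2 ⟩
    binom b o * (D + suc (suc d)) * (D + suc d) ≡⟨ cong (λ y → binom y o * (D + suc (suc d)) * (D + suc d)) hb1 ⟩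
    binom B1 o * (D + suc (suc d)) * (D + suc d) ≡⟨ cong (_* (D + suc d)) (binom-ratio o (D + suc (suc d))) ⟩
    binom B1 (suc o) * suc o * (D + suc d) ≡⟨ cong (λ y → binom y (suc o) * suc o * (D + suc d)) (sym hb1) ⟩
    binom b (suc o) * suc o * (D + suc d) ≡⟨ *-assoc (binom b (suc o)) (suc o) (D + suc d) ⟩
    binom b (suc o) * (suc o * (D + suc d)) ≡⟨ cong (binom b (suc o) *_) (*-comm (suc o) (D + suc d)) ⟩
    binom b (suc o) * ((D + suc d) * suc o) ≡⟨ sym (*-assoc (binom b (suc o)) (D + suc d) (suc o)) ⟩
    binom b (suc o) * (D + suc d) * suc o ≡⟨ cong (λ y → binom y (suc o) * (D + suc d) * suc o) hb2 ⟩
    binom B2 (suc o) * (D + suc d) * suc o ≡⟨ cong (_* suc o) (binom-ratio (suc o) (D + suc d)) ⟩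
    binom B2 (suc (suc o)) * suc (suc o) * suc o ≡⟨ cong (λ y → binom y (suc (suc o)) * suc (suc o) * suc o) (sym hb2) ⟩
    binom b (suc (suc o)) * suc (suc o) * suc o ≡⟨ cong (λ y → y * suc (suc o) * suc o) (sym (rest-shift d (suc (suc o)))) ⟩
    rest m d * suc (suc o) * suc o ∎
    where
    open ≡-Reasoning
    d m B1 B2 : ℕ
    d = dbl k
    m = d + suc (suc o)
    B1 = o + (D + suc (suc d))
    B2 = suc o + (D + suc d)
    e2 : rest m (suc (suc d)) ≡ binom b o
    e2 = trans (cong (λ y → rest y (suc (suc d))) (e d o)) (rest-shift (suc (suc d)) o)
      where e : ∀ d o → d + suc (suc o) ≡ suc (suc d) + o
            e = solve-∀
    hb1 : b ≡ B1
    hb1 = trans (sym hb) (e D d o)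
      where e : ∀ D d o → D + (d + suc (suc o)) ≡ o + (D + suc (suc d))
            e = solve-∀
    hb2 : b ≡ B2
    hb2 = trans (sym hb) (e D d o)
      where e : ∀ D d o → D + (d + suc (suc o)) ≡ suc o + (D + suc d)
            e = solve-∀


  left-step : ∀ n k D m → suc k ≤ m → D + m ≡ b →
    binom n (suc k) * rest m (suc k) * (suc k * (D + suc k)) ≤ binom n k * rest m k * (n * m)
  left-step n k D m k<m hb = begin
    binom n (suc k) * rest m (suc k) * (suc k * (D + suc k))
      ≡⟨ regroup (binom n (suc k)) (rest m (suc k)) (suc k) (D + suc k) ⟩
    (binom n (suc k) * suc k) * (rest m (suc k) * (D + suc k))
      ≤⟨ *-mono-≤ (binom-step≤ n k) (rest-ratio≤′ D m k k<m hb) ⟩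
    (binom n k * n) * (rest m k * m)
      ≡⟨ regroup (binom n k) n (rest m k) m ⟩
    binom n k * rest m k * (n * m) ∎
    where
    open ≤-Reasoning
    regroup : ∀ a b c e → (a * b) * (c * e) ≡ (a * c) * (b * e)
    regroup = solve-∀

  right-step : ∀ k D rt o → D + (dbl k + suc (suc o)) ≡ b →
    binom (dbl k + suc (suc rt)) (suc (suc (dbl k))) * rest (dbl k + suc (suc o)) (suc (suc (dbl k)))
      * ((suc (suc (dbl k)) * suc (dbl k)) * ((D + suc (suc (dbl k))) * (D + suc (dbl k))))
    ≡ binom (dbl k + suc (suc rt)) (dbl k) * rest (dbl k + suc (suc o)) (dbl k)
      * ((suc (suc rt) * suc rt) * (suc (suc o) * suc o))
  right-step k D rt o hb = begin
    binom t (suc (suc d)) * rest m (suc (suc d)) * ((suc (suc d) * suc d) * ((D + suc (suc d)) * (D + suc d)))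
      ≡⟨ spread (binom t (suc (suc d))) (rest m (suc (suc d))) (suc (suc d)) (suc d) (D + suc (suc d)) (D + suc d) ⟩
    (binom t (suc (suc d)) * suc (suc d) * suc d) * (rest m (suc (suc d)) * (D + suc (suc d)) * (D + suc d))
      ≡⟨ cong₂ _*_ (sym (binom-double k rt)) (rest-double D k o hb) ⟩
    (binom t d * suc (suc rt) * suc rt) * (rest m d * suc (suc o) * suc o)
      ≡⟨ gather (binom t d) (rest m d) (suc (suc rt)) (suc rt) (suc (suc o)) (suc o) ⟩
    binom t d * rest m d * ((suc (suc rt) * suc rt) * (suc (suc o) * suc o)) ∎
    where
    open ≡-Reasoning
    d m t : ℕ
    d = dbl k
    m = d + suc (suc o)
    t = d + suc (suc rt)
    spread : ∀ a b x y z w → (a * b) * ((x * y) * (z * w)) ≡ (a * x * y) * (b * z * w)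
    spread = solve-∀
    gather : ∀ a b x y z w → (a * x * y) * (b * z * w) ≡ (a * b) * ((x * y) * (z * w))
    gather = solve-∀

  -- One step k → k+1 of the termwise comparison: by left-step and right-step,
  -- termwise-arith is exactly what makes the ratio of the left side at most
  -- that of the right side.
  termwise-step : ∀ n k D rt o →
    D + (dbl k + suc (suc o)) ≡ b → b ≤ n → dbl k ≤ rt → dbl k ≤ o →
    64 * n * n * suc (dbl k) ≤ (dbl k + suc (suc rt)) * (dbl k + suc (suc rt)) * (dbl k + suc (suc o)) →
    binom n k * rest (dbl k + suc (suc o)) k ≤ binom (dbl k + suc (suc rt)) (dbl k) * rest (dbl k + suc (suc o)) (dbl k) →
    binom n (suc k) * rest (dbl k + suc (suc o)) (suc k) ≤ binom (dbl k + suc (suc rt)) (suc (suc (dbl k))) * rest (dbl k + suc (suc o)) (suc (suc (dbl k)))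
  termwise-step n k D rt o hb hbn hrt ho h64 ih = *-cancelʳ-≤ Lk1 R1' (P * P') {{nzPP}} chain
    where
    d m t P P' Q' NM L0 Lk1 R0 R1' : ℕ
    d = dbl k
    m = d + suc (suc o)
    t = d + suc (suc rt)
    P = suc k * (D + suc k)
    P' = (suc (suc d) * suc d) * ((D + suc (suc d)) * (D + suc d))
    Q' = (suc (suc rt) * suc rt) * (suc (suc o) * suc o)
    NM = n * m
    L0 = binom n k * rest m k
    Lk1 = binom n (suc k) * rest m (suc k)
    R0 = binom t d * rest m d
    R1' = binom t (suc (suc d)) * rest m (suc (suc d))
    nzD : NonZero (D + suc k)
    nzD = >-nonZero (≤-trans (s≤s z≤n) (m≤n+m (suc k) D))
    nzP : NonZero P
    nzP = m*n≢0 (suc k) (D + suc k) {{_}} {{nzD}}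
    nzP' : NonZero P'
    nzP' = m*n≢0 (suc (suc d) * suc d) ((D + suc (suc d)) * (D + suc d)) {{_}}
      {{m*n≢0 (D + suc (suc d)) (D + suc d) {{>-nonZero (≤-trans (s≤s z≤n) (m≤n+m (suc (suc d)) D))}} {{>-nonZero (≤-trans (s≤s z≤n) (m≤n+m (suc d) D))}}}}
    nzPP : NonZero (P * P')
    nzPP = m*n≢0 P P' {{nzP}} {{nzP'}}
    km : suc k ≤ m
    km = ≤-trans (s≤s (≤-trans kd (n≤1+n d))) (≤-trans (s≤s (s≤s (m≤m+n d o))) (≤-reflexive (e d o)))
      where e : ∀ d o → suc (suc (d + o)) ≡ d + suc (suc o)
            e = solve-∀
            kd : k ≤ d
            kd = ≤-trans (m≤m+n k (k + 0)) (≤-reflexive (sym (dbl≡ k)))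
    chain : Lk1 * (P * P') ≤ R1' * (P * P')
    chain = begin
      Lk1 * (P * P') ≡⟨ sym (*-assoc Lk1 P P') ⟩
      (Lk1 * P) * P' ≤⟨ *-monoˡ-≤ P' (left-step n k D m km hb) ⟩
      (L0 * NM) * P' ≤⟨ *-monoˡ-≤ P' (*-monoˡ-≤ NM ih) ⟩
      (R0 * NM) * P' ≡⟨ *-assoc R0 NM P' ⟩
      R0 * (NM * P') ≤⟨ *-monoʳ-≤ R0 (termwise-arith n k D rt o (≤-trans (≤-reflexive hb) hbn) hrt ho h64) ⟩
      R0 * (Q' * P) ≡⟨ sym (*-assoc R0 Q' P) ⟩
      (R0 * Q') * P ≡⟨ cong (_* P) (sym (right-step k D rt o hb)) ⟩
      (R1' * P') * P ≡⟨ *-assoc R1' P' P ⟩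
      R1' * (P' * P) ≡⟨ cong (R1' *_) (*-comm P' P) ⟩
      R1' * (P * P') ∎
      where open ≤-Reasoning

  termwise-step′ : ∀ n k D rt o t m → t ≡ dbl k + suc (suc rt) → m ≡ dbl k + suc (suc o) →
    D + m ≡ b → b ≤ n → dbl k ≤ rt → dbl k ≤ o →
    64 * n * n * suc (dbl k) ≤ t * t * m →
    binom n k * rest m k ≤ binom t (dbl k) * rest m (dbl k) →
    binom n (suc k) * rest m (suc k) ≤ binom t (suc (suc (dbl k))) * rest m (suc (suc (dbl k)))
  termwise-step′ n k D rt o t m refl refl = termwise-step n k D rt o

  splitAbove : ∀ d x → suc (suc (d + d)) ≤ x → Σ ℕ λ r → (x ≡ d + suc (suc r)) × (d ≤ r)
  splitAbove d x h with m≤n⇒∃[o]m+o≡n (≤-trans (s≤s (s≤s (m≤m+n d d))) h)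
  ... | r , eq = r , trans (sym eq) (e d r) , le
    where
    e : ∀ d r → suc (suc d) + r ≡ d + suc (suc r)
    e = solve-∀
    le : d ≤ r
    le = +-cancelˡ-≤ (suc (suc d)) d r (≤-trans (≤-reflexive (e2 d)) (≤-trans h (≤-reflexive (sym eq))))
      where e2 : ∀ d → suc (suc d) + d ≡ suc (suc (d + d))
            e2 = solve-∀

  termwise : ∀ n t m D K → D + m ≡ b → b ≤ n → 4 * K ≤ t → 4 * K ≤ m → 64 * n * n * (2 * K) ≤ t * t * m →
    ∀ k → k ≤ K → binom n k * rest m k ≤ binom t (dbl k) * rest m (dbl k)
  termwise n t m D K hb hbn ht hm h64 zero _ = ≤-refl
  termwise n t m D K hb hbn ht hm h64 (suc k) hk with splitAbove (dbl k) t (≤-trans c4 ht) | splitAbove (dbl k) m (≤-trans c4 hm)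
    where
    c4 : suc (suc (dbl k + dbl k)) ≤ 4 * K
    c4 = ≤-trans (≤-trans (n≤1+n _) (≤-trans (n≤1+n _) (≤-reflexive (e k)))) (*-monoʳ-≤ 4 hk)
      where e : ∀ k → suc (suc (suc (suc (dbl k + dbl k)))) ≡ 4 * suc k
            e k rewrite dbl≡ k = e' k
              where e' : ∀ k → suc (suc (suc (suc (2 * k + 2 * k)))) ≡ 4 * suc k
                    e' = solve-∀
  ... | rt , et , lt | o , em , lo = termwise-step′ n k D rt o t m et em hb hbn lt lo h64' (termwise n t m D K hb hbn ht hm h64 k (≤-trans (n≤1+n k) hk))
    where
    h64' : 64 * n * n * suc (dbl k) ≤ t * t * m
    h64' = ≤-trans (*-monoʳ-≤ (64 * n * n) (≤-trans (≤-reflexive (cong suc (dbl≡ k))) (≤-trans (n≤1+n _) (≤-trans (≤-reflexive (e k)) (*-monoʳ-≤ 2 hk))))) h64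
      where e : ∀ k → suc (suc (2 * k)) ≡ 2 * suc k
            e = solve-∀

  -- evenSum t K m = Σ_{k ≤ K} C(t,2k)·C(b,m-2k), the even terms of vsum t (2K) m.
  evenSum : ℕ → ℕ → ℕ → ℕ
  evenSum t zero m = binom t 0 * rest m 0
  evenSum t (suc K) m = evenSum t K m + binom t (dbl (suc K)) * rest m (dbl (suc K))

  vsum≤evenSum : ∀ n t m K → (∀ k → k ≤ K → binom n k * rest m k ≤ binom t (dbl k) * rest m (dbl k)) → vsum n K m ≤ evenSum t K m
  vsum≤evenSum n t m zero h = h 0 z≤n
  vsum≤evenSum n t m (suc K) h = +-mono-≤ (vsum≤evenSum n t m K (λ k hk → h k (≤-trans hk (n≤1+n K)))) (h (suc K) ≤-refl)

  evenSum≤vsum : ∀ t m K → evenSum t K m ≤ vsum t (dbl K) m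
  evenSum≤vsum t m zero = ≤-refl
  evenSum≤vsum t m (suc K) = +-monoˡ-≤ (binom t (dbl (suc K)) * rest m (dbl (suc K))) (≤-trans (evenSum≤vsum t m K) (m≤m+n (vsum t (dbl K) m) (binom t (suc (dbl K)) * rest m (suc (dbl K)))))

  vsum-empty : ∀ J m → vsum 0 J m ≡ binom b m
  vsum-empty zero m = +-identityʳ (binom b m)
  vsum-empty (suc J) m = trans (+-identityʳ (vsum 0 J m)) (vsum-empty J m)

  vandermonde : ∀ t J m → vsum t J m ≤ binom (b + t) m
  vandermonde zero J m = ≤-reflexive (trans (vsum-empty J m) (cong (λ y → binom y m) (sym (+-identityʳ b))))
  vandermonde (suc t) J m = ≤-trans (≤-reflexive (vsum-pascal t J m)) (≤-trans (halves J m) (≤-reflexive (cong (λ y → binom y m) (sym (+-suc b t)))))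
    where
    halves : ∀ J m → vsum t J m + vsum⁺ t J m ≤ binom (suc (b + t)) m
    halves J zero = ≤-trans (≤-reflexive (trans (cong (vsum t J 0 +_) (vsum⁺-zero t J)) (+-identityʳ _))) (vandermonde t J 0)
    halves zero (suc m) = ≤-trans (≤-reflexive (+-identityʳ _)) (≤-trans (vandermonde t 0 (suc m)) (m≤n+m _ _))
    halves (suc J) (suc m) = ≤-trans (+-mono-≤ (vandermonde t (suc J) (suc m)) (≤-trans (≤-reflexive (vsum⁺-suc t J m)) (vandermonde t J m)))
      (≤-reflexive (+-comm (binom (b + t) (suc m)) (binom (b + t) m)))


module DensePeeling where

  open import Data.Nat using (ℕ; zero; suc; pred; _+_; _*_; _≤_; _<_; z≤n; s≤s; _≤?_; >-nonZero)
  open import Data.Nat.Properties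
  open import Data.Product using (_,_)
  open import Data.Empty using (⊥-elim)
  open import Relation.Nullary using (yes; no)
  open import Relation.Binary.PropositionalEquality
  open import Defs hiding (sym)
  open Graphs
  open Binomial
  open Peeling

  module _ {n} (G : Graph n) (b q : ℕ) (dense : ∀ B → b < size B → q * size B ≤ 2 * e G B) where

    open Vandermonde b

    -- Induction on K (dense peelings still allowed) and on a bound s for |B|:
    -- the branch B ∖ v keeps K, the branch B ∖ N[v] loses ≥ q+1 vertices and
    -- one unit of K.
    indepIn≤vsum : ∀ K s B m → size B ≤ s → size B ≤ b + K * suc q → indepIn G B m ≤ vsum (size B) K m
    indepIn≤vsum K s B m |B|≤s |B|≤bound with size B ≤? b
    ... | yes small = ≤-trans (indepIn≤binom G (size B) B m ≤-refl)
                              (≤-trans (binom-mono m small) (rest≤vsum (size B) K m))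
    indepIn≤vsum zero s B m |B|≤s |B|≤bound | no large =
      ⊥-elim (large (≤-trans |B|≤bound (≤-reflexive (+-identityʳ b))))
    indepIn≤vsum (suc K) zero B m |B|≤s |B|≤bound | no large = ⊥-elim (large (≤-trans |B|≤s z≤n))
    indepIn≤vsum (suc K) (suc s) B m |B|≤s |B|≤bound | no large
      with highDegreeVertex G B q (dense B (≰⇒> large)) (≤-<-trans z≤n (≰⇒> large))
    ... | v , v∈B , q≤deg =
      ≤-trans (peel G B v m) (≤-trans (+-mono-≤ avoidBranch (containBranch m)) (≤-reflexive (sym pascal)))
      where
      x : ℕ
      x = pred (size B)
      |B|≡1+x : size B ≡ suc x
      |B|≡1+x = sym (suc-pred (size B) {{>-nonZero (≤-<-trans z≤n (≰⇒> large))}})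
      |B∖v|<|B| : suc (size (without B v)) ≤ size B
      |B∖v|<|B| = size-without B v v∈B
      avoidBranch : indepIn G (without B v) m ≤ vsum x (suc K) m
      avoidBranch = ≤-trans
        (indepIn≤vsum (suc K) s (without B v) m (≤-pred (≤-trans |B∖v|<|B| |B|≤s))
                      (≤-trans (n≤1+n _) (≤-trans |B∖v|<|B| |B|≤bound)))
        (vsum-mono (suc K) m (≤-pred (≤-trans |B∖v|<|B| (≤-reflexive |B|≡1+x))))
      |B∖N[v]|<|B| : suc (size (outsideNbhd G B v) + degIn G B v) ≤ size B
      |B∖N[v]|<|B| = size-outsideNbhd G B v v∈B
      |B∖N[v]|≤bound : size (outsideNbhd G B v) ≤ b + K * suc q
      |B∖N[v]|≤bound = +-cancelʳ-≤ (suc q) _ _ (begin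
        size (outsideNbhd G B v) + suc q      ≡⟨ +-suc _ q ⟩
        suc (size (outsideNbhd G B v) + q)    ≤⟨ s≤s (+-monoʳ-≤ _ q≤deg) ⟩
        suc (size (outsideNbhd G B v) + degIn G B v) ≤⟨ |B∖N[v]|<|B| ⟩
        size B                                ≤⟨ |B|≤bound ⟩
        b + (suc q + K * suc q)               ≡⟨ cong (b +_) (+-comm (suc q) (K * suc q)) ⟩
        b + (K * suc q + suc q)               ≡⟨ sym (+-assoc b _ _) ⟩
        b + K * suc q + suc q                 ∎)
        where open ≤-Reasoning
      containBranch : ∀ m → nbhdCount G B v m ≤ vsum⁺ x (suc K) m
      containBranch zero = z≤n
      containBranch (suc m) = ≤-trans
        (indepIn≤vsum K (size (outsideNbhd G B v)) (outsideNbhd G B v) m ≤-refl |B∖N[v]|≤bound)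
        (≤-trans (vsum-mono K m (≤-pred (≤-trans (s≤s (m≤m+n _ _)) (≤-trans |B∖N[v]|<|B| (≤-reflexive |B|≡1+x)))))
                 (≤-reflexive (sym (vsum⁺-suc x K m))))
      pascal : vsum (size B) (suc K) m ≡ vsum x (suc K) m + vsum⁺ x (suc K) m
      pascal = trans (cong (λ y → vsum y (suc K) m) |B|≡1+x) (vsum-pascal x (suc K) m)

-- The choice of parameters: with d ≥ M = 1536·a·c², q = ⌊d/a⌋, t = ⌊n/c⌋,
-- K = ⌊n/(q+1)⌋ + 1 and M·n ≤ m·d, the hypotheses of the termwise comparison
-- hold (a and c are the denominators of ε and δ).
module Parameters where

  open import Data.Nat using (ℕ; suc; _+_; _*_; _≤_; _<_; z≤n; s≤s; >-nonZero)
  open import Data.Nat.Properties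
  open import Data.Nat.Tactic.RingSolver using (solve-∀)
  open import Data.Product using (_×_; _,_)
  open import Relation.Binary.PropositionalEquality

  1≤* : ∀ {x y} → 1 ≤ x → 1 ≤ y → 1 ≤ x * y
  1≤* = *-mono-≤

  M≤d : ∀ M n m d → 1 ≤ n → M * n ≤ m * d → m ≤ n → M ≤ d
  M≤d M n m d 1≤n Mn≤md m≤n =
    *-cancelʳ-≤ M d n {{>-nonZero 1≤n}} (≤-trans Mn≤md (≤-trans (*-monoˡ-≤ d m≤n) (≤-reflexive (*-comm n d))))

  a≤M : ∀ a c → 1 ≤ c → a ≤ 1536 * a * c * c
  a≤M a c 1≤c = ≤-trans (≤-reflexive (sym (*-identityʳ a)))
    (≤-trans (*-monoʳ-≤ a (1≤* (1≤* {1536} (s≤s z≤n) 1≤c) 1≤c)) (≤-reflexive (e a c)))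
    where e : ∀ a c → a * (1536 * c * c) ≡ 1536 * a * c * c
          e = solve-∀

  parameterBounds : ∀ a c n d m q t K →
    1 ≤ a → 1 ≤ c → 1 ≤ n →
    1536 * a * c * c * n ≤ m * d → d ≤ n → m ≤ n →
    d < suc q * a → q ≤ d →
    K * suc q ≤ n + suc q →
    n < suc t * c →
    (4 * K ≤ t) × (4 * K ≤ m) × (64 * n * n * (2 * K) ≤ t * t * m)
  parameterBounds a c n d m q t K 1≤a 1≤c 1≤n Mn≤md d≤n m≤n d<[q+1]a q≤d K[q+1]≤n+q+1 n<[t+1]c =
    4K≤t , 4K≤m , 128n²K≤t²m
    where
    open ≤-Reasoning
    M : ℕ
    M = 1536 * a * c * c
    1≤M : 1 ≤ M
    1≤M = 1≤* (1≤* (1≤* {1536} (s≤s z≤n) 1≤a) 1≤c) 1≤c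
    M≤d′ : M ≤ d
    M≤d′ = M≤d M n m d 1≤n Mn≤md m≤n
    1≤d : 1 ≤ d
    1≤d = ≤-trans 1≤M M≤d′
    24ac≤M : 24 * a * c ≤ M
    24ac≤M = ≤-trans (≤-reflexive (sym (*-identityʳ (24 * a * c))))
      (≤-trans (*-monoʳ-≤ (24 * a * c) (1≤* {64} (s≤s z≤n) 1≤c)) (≤-reflexive (e a c)))
      where e : ∀ a c → 24 * a * c * (64 * c) ≡ 1536 * a * c * c
            e = solve-∀
    12a≤M : 12 * a ≤ M
    12a≤M = ≤-trans (≤-reflexive (sym (*-identityʳ (12 * a))))
      (≤-trans (*-monoʳ-≤ (12 * a) (1≤* {2} (s≤s z≤n) 1≤c)) (≤-trans (≤-reflexive (e a c)) 24ac≤M))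
      where e : ∀ a c → 12 * a * (2 * c) ≡ 24 * a * c
            e = solve-∀
    2c≤n : 2 * c ≤ n
    2c≤n = ≤-trans (≤-reflexive (sym (*-identityʳ (2 * c))))
      (≤-trans (*-monoʳ-≤ (2 * c) (1≤* (1≤* {768} (s≤s z≤n) 1≤a) 1≤c))
        (≤-trans (≤-reflexive (e a c)) (≤-trans M≤d′ d≤n)))
      where e : ∀ a c → 2 * c * (768 * a * c) ≡ 1536 * a * c * c
            e = solve-∀
    q+1≤2n : suc q ≤ n + n
    q+1≤2n = ≤-trans (s≤s (≤-trans q≤d d≤n)) (≤-trans (≤-reflexive (+-comm 1 n)) (+-monoʳ-≤ n 1≤n))
    Kd≤3an : K * d ≤ 3 * a * n
    Kd≤3an = begin
      K * d                 ≤⟨ *-monoʳ-≤ K (<⇒≤ d<[q+1]a) ⟩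
      K * (suc q * a)       ≡⟨ sym (*-assoc K (suc q) a) ⟩
      K * suc q * a         ≤⟨ *-monoˡ-≤ a K[q+1]≤n+q+1 ⟩
      (n + suc q) * a       ≤⟨ *-monoˡ-≤ a (+-monoʳ-≤ n q+1≤2n) ⟩
      (n + (n + n)) * a     ≡⟨ e n a ⟩
      3 * a * n             ∎
      where e : ∀ n a → (n + (n + n)) * a ≡ 3 * a * n
            e = solve-∀
    n≤2tc : n ≤ 2 * (t * c)
    n≤2tc = <⇒≤ (+-cancelˡ-< n n (2 * (t * c)) (begin-strict
      n + n                    ≡⟨ e n ⟩
      2 * n                    <⟨ *-monoʳ-< 2 n<[t+1]c ⟩
      2 * (suc t * c)          ≡⟨ e2 t c ⟩
      2 * c + 2 * (t * c)      ≤⟨ +-monoˡ-≤ (2 * (t * c)) 2c≤n ⟩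
      n + 2 * (t * c)          ∎))
      where e : ∀ n → n + n ≡ 2 * n
            e = solve-∀
            e2 : ∀ t c → 2 * (suc t * c) ≡ 2 * c + 2 * (t * c)
            e2 = solve-∀
    4K≤t : 4 * K ≤ t
    4K≤t = *-cancelʳ-≤ (4 * K) t (2 * c * d) {{>-nonZero (1≤* (1≤* {2} (s≤s z≤n) 1≤c) 1≤d)}} (begin
      4 * K * (2 * c * d)       ≡⟨ e1 K c d ⟩
      8 * c * (K * d)           ≤⟨ *-monoʳ-≤ (8 * c) Kd≤3an ⟩
      8 * c * (3 * a * n)       ≡⟨ e2 a c n ⟩
      24 * a * c * n            ≤⟨ *-monoˡ-≤ n (≤-trans 24ac≤M M≤d′) ⟩
      d * n                     ≤⟨ *-monoʳ-≤ d n≤2tc ⟩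
      d * (2 * (t * c))         ≡⟨ e3 d t c ⟩
      t * (2 * c * d)           ∎)
      where e1 : ∀ K c d → 4 * K * (2 * c * d) ≡ 8 * c * (K * d)
            e1 = solve-∀
            e2 : ∀ a c n → 8 * c * (3 * a * n) ≡ 24 * a * c * n
            e2 = solve-∀
            e3 : ∀ d t c → d * (2 * (t * c)) ≡ t * (2 * c * d)
            e3 = solve-∀
    4K≤m : 4 * K ≤ m
    4K≤m = *-cancelʳ-≤ (4 * K) m d {{>-nonZero 1≤d}} (begin
      4 * K * d           ≡⟨ *-assoc 4 K d ⟩
      4 * (K * d)         ≤⟨ *-monoʳ-≤ 4 Kd≤3an ⟩
      4 * (3 * a * n)     ≡⟨ e a n ⟩
      12 * a * n          ≤⟨ *-monoˡ-≤ n 12a≤M ⟩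
      M * n               ≤⟨ Mn≤md ⟩
      m * d               ∎)
      where e : ∀ a n → 4 * (3 * a * n) ≡ 12 * a * n
            e = solve-∀
    128n²K≤t²m : 64 * n * n * (2 * K) ≤ t * t * m
    128n²K≤t²m = *-cancelʳ-≤ (64 * n * n * (2 * K)) (t * t * m) (4 * c * c * d)
      {{>-nonZero (1≤* (1≤* (1≤* {4} (s≤s z≤n) 1≤c) 1≤c) 1≤d)}} (begin
      64 * n * n * (2 * K) * (4 * c * c * d)      ≡⟨ e1 n K c d ⟩
      512 * c * c * n * n * (K * d)               ≤⟨ *-monoʳ-≤ (512 * c * c * n * n) Kd≤3an ⟩
      512 * c * c * n * n * (3 * a * n)           ≡⟨ e2 a c n ⟩
      n * n * (M * n)                             ≤⟨ *-monoʳ-≤ (n * n) Mn≤md ⟩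
      n * n * (m * d)                             ≤⟨ *-monoˡ-≤ (m * d) (*-mono-≤ n≤2tc n≤2tc) ⟩
      2 * (t * c) * (2 * (t * c)) * (m * d)       ≡⟨ e3 t c m d ⟩
      t * t * m * (4 * c * c * d)                 ∎)
      where e1 : ∀ n K c d → 64 * n * n * (2 * K) * (4 * c * c * d) ≡ 512 * c * c * n * n * (K * d)
            e1 = solve-∀
            e2 : ∀ a c n → 512 * c * c * n * n * (3 * a * n) ≡ n * n * (1536 * a * c * c * n)
            e2 = solve-∀
            e3 : ∀ t c m d → 2 * (t * c) * (2 * (t * c)) * (m * d) ≡ t * t * m * (4 * c * c * d)
            e3 = solve-∀

module CountingBound where

  open import Data.Bool using (true; _∧_)
  open import Data.Nat using (ℕ; suc; _+_; _*_; _∸_; _≤_; _<_; z≤n; _≟_; _≤?_; >-nonZero)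
  open import Data.Nat.Properties
  open import Data.Vec using (replicate)
  open import Data.Vec.Properties using (lookup-replicate)
  open import Data.Product using (_,_)
  open import Data.Empty using (⊥)
  open import Relation.Nullary using (yes; no)
  open import Relation.Nullary.Decidable using (⌊_⌋)
  open import Relation.Binary.PropositionalEquality
  open import Defs hiding (sym)
  open Counting
  open Graphs
  open Binomial
  open Peeling
  open DensePeeling

  everything : ∀ n → VSet n
  everything n = replicate n true

  I≤indepIn-everything : ∀ {n} (G : Graph n) m → I G m ≤ indepIn G (everything n) m
  I≤indepIn-everything {n} G m =
    ≤-trans (≤-reflexive (countL-allSubsets (λ A → ⌊ size A ≟ m ⌋ ∧ isIndependent G A)))
            (sumS-mono (λ A → bit-mono (λ h → indepSubset?⇐ G (everything n) m A (unpack A h))))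
    where
    unpack : ∀ A → (⌊ size A ≟ m ⌋ ∧ isIndependent G A) ≡ true → IndepSubset G (everything n) m A
    unpack A h with ∧-true⁻ {⌊ size A ≟ m ⌋} h
    ... | sz , ind = ⌊⌋⇒ (size A ≟ m) sz , isIndependent⇒Indep G A ind , λ u _ → lookup-replicate u true

  module _ {n} (G : Graph n) (b q : ℕ) (dense : ∀ B → b < size B → q * size B ≤ 2 * e G B) (1≤q : 1 ≤ q) where

    open Vandermonde b

    -- A set larger than b is dense, hence spans an edge.
    largeNotIndep : ∀ A → Indep G A → b < size A → ⊥
    largeNotIndep A ind b<|A| = <-irrefl refl (≤-trans b<|A| (≤-trans |A|≤0 z≤n))
      where
      |A|≤0 : size A ≤ 0
      |A|≤0 = begin
        size A        ≤⟨ m≤n*m (size A) q {{>-nonZero 1≤q}} ⟩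
        q * size A    ≤⟨ dense A b<|A| ⟩
        2 * e G A     ≡⟨ cong (2 *_) (Indep⇒e≡0 G A ind) ⟩
        0             ∎
        where open ≤-Reasoning

    countingBound : ∀ t K m → n ≤ b + K * suc q → b ≤ n →
      4 * K ≤ t → 4 * K ≤ m → 64 * n * n * (2 * K) ≤ t * t * m →
      I G m ≤ binom (b + t) m
    countingBound t K m n≤bound b≤n 4K≤t 4K≤m 128n²K≤t²m with m ≤? b
    ... | yes m≤b = begin
      I G m               ≤⟨ I≤indepIn-everything G m ⟩
      indepIn G V m       ≤⟨ indepIn≤vsum G b q dense K n V m (size≤n V) (≤-trans (size≤n V) n≤bound) ⟩
      vsum (size V) K m   ≤⟨ vsum-mono K m (size≤n V) ⟩
      vsum n K m          ≤⟨ vsum≤evenSum n t m K (termwise n t m (b ∸ m) K (m∸n+n≡m m≤b) b≤n 4K≤t 4K≤m 128n²K≤t²m) ⟩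
      evenSum t K m       ≤⟨ evenSum≤vsum t m K ⟩
      vsum t (dbl K) m    ≤⟨ vandermonde t (dbl K) m ⟩
      binom (b + t) m     ∎
      where
      open ≤-Reasoning
      V : VSet n
      V = everything n
    ... | no m≰b = ≤-trans (I≤indepIn-everything G m)
      (≤-trans (sumS-mono (λ A → bit-none (λ h → noSet A (indepSubset?⇒ G (everything n) m A h))))
               (≤-trans (≤-reflexive (sumS-zero {n})) z≤n))
      where
      noSet : ∀ A → IndepSubset G (everything n) m A → ⊥
      noSet A (sz , ind , _) = largeNotIndep A ind (subst (b <_) (sym sz) (≰⇒> m≰b))

module Rationals where

  open import Data.Bool using (if_then_else_)
  open import Data.Nat as ℕ using (ℕ; zero; suc)
  import Data.Nat.Properties as ℕₚ
  open import Data.Integer as ℤ using (+_; +[1+_]; -[1+_])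
  import Data.Integer.Properties as ℤₚ
  open import Data.Rational using (ℚ; mkℚ; toℚᵘ; 0ℚ; 1ℚ; _≤_; _<_; _*_; _+_; _-_; -_; ↧ₙ_; *≤*; *<*; nonNegative)
  open import Data.Rational.Properties
  import Data.Rational.Unnormalised as ℚᵘ
  import Data.Rational.Unnormalised.Properties as ℚᵘₚ
  open import Data.Nat.Coprimality using (1-coprimeTo) renaming (sym to coprime-sym)
  open import Data.Product using (Σ; _×_; _,_)
  open import Data.Empty using (⊥-elim)
  open import Relation.Nullary using (Dec; yes; no)
  open import Relation.Nullary.Decidable using (does)
  open import Relation.Binary.PropositionalEquality
  open import Algebra.Bundles using (CommutativeMonoid)
  open import Algebra.Properties.CommutativeSemigroup (CommutativeMonoid.commutativeSemigroup *-1-commutativeMonoid)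
    using (x∙yz≈y∙xz; xy∙z≈xz∙y)
  open import Defs hiding (sym)
  open Binomial using (binom; binom-ratio; binom-zero)

  ℕ→ℚ-normal : ∀ k → ℕ→ℚ k ≡ mkℚ (+ k) 0 (coprime-sym (1-coprimeTo k))
  ℕ→ℚ-normal k = normalize-coprime (coprime-sym (1-coprimeTo k))

  ℕ→ℚ-+ : ∀ a b → ℕ→ℚ (a ℕ.+ b) ≡ ℕ→ℚ a + ℕ→ℚ b
  ℕ→ℚ-+ a b rewrite ℕ→ℚ-normal a | ℕ→ℚ-normal b = cong (Data.Rational._/ 1) (sym eq)
    where
    eq : + a ℤ.* + 1 ℤ.+ + b ℤ.* + 1 ≡ + (a ℕ.+ b)
    eq = trans (cong₂ ℤ._+_ (ℤₚ.*-identityʳ (+ a)) (ℤₚ.*-identityʳ (+ b))) (sym (ℤₚ.pos-+ a b))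

  ℕ→ℚ-* : ∀ a b → ℕ→ℚ (a ℕ.* b) ≡ ℕ→ℚ a * ℕ→ℚ b
  ℕ→ℚ-* a b rewrite ℕ→ℚ-normal a | ℕ→ℚ-normal b = cong (Data.Rational._/ 1) (ℤₚ.pos-* a b)

  ℕ→ℚ-mono : ∀ {a b} → a ℕ.≤ b → ℕ→ℚ a ≤ ℕ→ℚ b
  ℕ→ℚ-mono {a} {b} a≤b rewrite ℕ→ℚ-normal a | ℕ→ℚ-normal b = *≤* (ℤₚ.*-monoʳ-≤-nonNeg (+ 1) (ℤ.+≤+ a≤b))

  ℕ→ℚ-cancel : ∀ {a b} → ℕ→ℚ a ≤ ℕ→ℚ b → a ℕ.≤ b
  ℕ→ℚ-cancel {a} {b} a≤b rewrite ℕ→ℚ-normal a | ℕ→ℚ-normal b with a≤b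
  ... | *≤* p = ℤₚ.drop‿+≤+ (subst₂ ℤ._≤_ (ℤₚ.*-identityʳ (+ a)) (ℤₚ.*-identityʳ (+ b)) p)

  ℕ→ℚ-nonNeg : ∀ k → 0ℚ ≤ ℕ→ℚ k
  ℕ→ℚ-nonNeg k = ℕ→ℚ-mono {0} {k} ℕ.z≤n

  1≤ε*denominator : ∀ (ε : ℚ) → 0ℚ < ε → 1ℚ ≤ ε * ℕ→ℚ (↧ₙ ε)
  1≤ε*denominator ε@(mkℚ +[1+ p ] d-1 _) _ =
    toℚᵘ-cancel-≤ (ℚᵘₚ.≤-respʳ-≃ (ℚᵘₚ.≃-sym (toℚᵘ-homo-* ε (ℕ→ℚ (suc d-1)))) unnormalised)
    where
    d-1≤numerator : d-1 ℕ.≤ (d-1 ℕ.+ p ℕ.* suc d-1) ℕ.* 1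
    d-1≤numerator = ℕₚ.≤-trans (ℕₚ.m≤m+n d-1 (p ℕ.* suc d-1))
                               (ℕₚ.≤-reflexive (sym (ℕₚ.*-identityʳ (d-1 ℕ.+ p ℕ.* suc d-1))))
    unnormalised : toℚᵘ 1ℚ ℚᵘ.≤ (toℚᵘ ε ℚᵘ.* toℚᵘ (ℕ→ℚ (suc d-1)))
    unnormalised rewrite ℕ→ℚ-normal (suc d-1) =
      ℚᵘ.*≤* (ℤ.+≤+ (ℕ.s≤s (ℕₚ.≤-trans (ℕₚ.≤-reflexive (trans (ℕₚ.+-identityʳ (d-1 ℕ.* 1)) (ℕₚ.*-identityʳ d-1)))
                                          d-1≤numerator)))
  1≤ε*denominator (mkℚ (+ 0) _ _) (*<* (ℤ.+<+ ()))
  1≤ε*denominator (mkℚ -[1+ _ ] _ _) (*<* ())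

  ≤-scale : ∀ (ε : ℚ) (q a d : ℕ) → 0ℚ ≤ ε → 1ℚ ≤ ε * ℕ→ℚ a → q ℕ.* a ℕ.≤ d → ℕ→ℚ q ≤ ε * ℕ→ℚ d
  ≤-scale ε q a d 0≤ε 1≤εa qa≤d = begin
    ℕ→ℚ q                      ≡⟨ sym (*-identityʳ (ℕ→ℚ q)) ⟩
    ℕ→ℚ q * 1ℚ                 ≤⟨ *-monoˡ-≤-nonNeg (ℕ→ℚ q) {{nonNegative (ℕ→ℚ-nonNeg q)}} 1≤εa ⟩
    ℕ→ℚ q * (ε * ℕ→ℚ a)        ≡⟨ x∙yz≈y∙xz (ℕ→ℚ q) ε (ℕ→ℚ a) ⟩
    ε * (ℕ→ℚ q * ℕ→ℚ a)        ≡⟨ cong (ε *_) (sym (ℕ→ℚ-* q a)) ⟩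
    ε * ℕ→ℚ (q ℕ.* a)          ≤⟨ *-monoˡ-≤-nonNeg ε {{nonNegative 0≤ε}} (ℕ→ℚ-mono qa≤d) ⟩
    ε * ℕ→ℚ d                  ∎
    where open ≤-Reasoning

  -- Rounding r down within [0, n]: the largest b ≤ n with b ≤ r (or 0).
  Threshold : ℚ → ℕ → Set
  Threshold r n = Σ ℕ λ b → (b ℕ.≤ n) × (ℕ→ℚ b ≤ r) × (∀ k → k ℕ.≤ n → b ℕ.< k → r ≤ ℕ→ℚ k)

  threshold : (r : ℚ) → 0ℚ ≤ r → (n : ℕ) → Threshold r n
  threshold r 0≤r zero = 0 , ℕ.z≤n , 0≤r , λ k k≤0 0<k → ⊥-elim (ℕₚ.<⇒≱ 0<k k≤0)
  threshold r 0≤r (suc n) = extend (ℕ→ℚ (suc n) ≤? r) (threshold r 0≤r n)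
    where
    extend : Dec (ℕ→ℚ (suc n) ≤ r) → Threshold r n → Threshold r (suc n)
    extend (yes top) _ = suc n , ℕₚ.≤-refl , top , λ k k≤1+n 1+n<k → ⊥-elim (ℕₚ.<⇒≱ 1+n<k k≤1+n)
    extend (no ¬top) (b , b≤n , b≤r , above) = b , ℕₚ.m≤n⇒m≤1+n b≤n , b≤r , λ k k≤1+n → above′ k k≤1+n (k ℕ.≟ suc n)
      where
      above′ : ∀ k → k ℕ.≤ suc n → Dec (k ≡ suc n) → b ℕ.< k → r ≤ ℕ→ℚ k
      above′ k _ (yes refl) _ = <⇒≤ (≰⇒> ¬top)
      above′ k k≤1+n (no k≢1+n) b<k = above k (ℕₚ.≤-pred (ℕₚ.≤∧≢⇒< k≤1+n k≢1+n)) b<k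

  inverse : ℕ → ℚ
  inverse m = (+ 1) Data.Rational./ suc m

  inverse-inv : ∀ m → ℕ→ℚ (suc m) * inverse m ≡ 1ℚ
  inverse-inv m rewrite ℕ→ℚ-normal (suc m) =
    trans (cong (mkℚ (+ suc m) 0 (coprime-sym (1-coprimeTo (suc m))) *_) (normalize-coprime {1} {m} (1-coprimeTo (suc m))))
          (*-inverseʳ (mkℚ (+ suc m) 0 (coprime-sym (1-coprimeTo (suc m)))))

  inverse-nonNeg : ∀ m → 0ℚ ≤ inverse m
  inverse-nonNeg m = subst (0ℚ ≤_) (sym (normalize-coprime {1} {m} (1-coprimeTo (suc m)))) (*≤* (ℤ.+≤+ ℕ.z≤n))

  *-nonNeg : ∀ {a b} → 0ℚ ≤ a → 0ℚ ≤ b → 0ℚ ≤ a * b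
  *-nonNeg {a} {b} 0≤a 0≤b = subst (_≤ a * b) (*-zeroˡ b) (*-monoʳ-≤-nonNeg b {{nonNegative 0≤b}} 0≤a)

  *-mono-nonNeg : ∀ {a a' b b'} → 0ℚ ≤ a → a ≤ a' → 0ℚ ≤ b → b ≤ b' → a * b ≤ a' * b'
  *-mono-nonNeg {a} {a'} {b} {b'} 0≤a a≤a' 0≤b b≤b' =
    ≤-trans (*-monoʳ-≤-nonNeg b {{nonNegative 0≤b}} a≤a')
            (*-monoˡ-≤-nonNeg a' {{nonNegative (≤-trans 0≤a a≤a')}} b≤b')

  x≤x+1 : ∀ x → x ≤ x + 1ℚ
  x≤x+1 x = subst (_≤ x + 1ℚ) (+-identityʳ x) (+-monoʳ-≤ x (*≤* (ℤ.+≤+ ℕ.z≤n)))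

  a+b-a≡b : ∀ a b → (a + b) - a ≡ b
  a+b-a≡b a b = trans (cong (_- a) (+-comm a b)) (trans (+-assoc b a (- a)) (trans (cong (λ z → b + z) (+-inverseʳ a)) (+-identityʳ b)))

  binom-suc-ℚ : ∀ m r → ℕ→ℚ (binom (m ℕ.+ r) (suc m)) ≡ ℕ→ℚ (binom (m ℕ.+ r) m) * (ℕ→ℚ r * inverse m)
  binom-suc-ℚ m r = begin
    L c₁                                ≡⟨ sym (*-identityʳ (L c₁)) ⟩
    L c₁ * 1ℚ                           ≡⟨ cong (L c₁ *_) (sym (inverse-inv m)) ⟩
    L c₁ * (L (suc m) * inverse m)      ≡⟨ sym (*-assoc (L c₁) (L (suc m)) (inverse m)) ⟩
    (L c₁ * L (suc m)) * inverse m      ≡⟨ cong (_* inverse m) (sym (ℕ→ℚ-* c₁ (suc m))) ⟩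
    L (c₁ ℕ.* suc m) * inverse m        ≡⟨ cong (λ z → L z * inverse m) (sym (binom-ratio m r)) ⟩
    L (c₀ ℕ.* r) * inverse m            ≡⟨ cong (_* inverse m) (ℕ→ℚ-* c₀ r) ⟩
    (L c₀ * L r) * inverse m            ≡⟨ *-assoc (L c₀) (L r) (inverse m) ⟩
    L c₀ * (L r * inverse m)            ∎
    where
    open ≡-Reasoning
    L : ℕ → ℚ
    L = ℕ→ℚ
    c₀ c₁ : ℕ
    c₀ = binom (m ℕ.+ r) m
    c₁ = binom (m ℕ.+ r) (suc m)

  binom≤binomPoly : ∀ x N m → m ℕ.≤ N → ℕ→ℚ N ≤ x → ℕ→ℚ (binom N m) ≤ binomPoly x m
  binom≤binomPoly x N zero _ _ = ≤-refl
  binom≤binomPoly x N (suc m) m<N N≤x with ℕₚ.m≤n⇒∃[o]m+o≡n (ℕₚ.≤-trans (ℕₚ.n≤1+n m) m<N)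
  ... | r , refl = subst (_≤ binomPoly x (suc m)) (sym (binom-suc-ℚ m r))
    (*-mono-nonNeg (ℕ→ℚ-nonNeg (binom (m ℕ.+ r) m)) (binom≤binomPoly x (m ℕ.+ r) m (ℕₚ.m≤m+n m r) N≤x)
                   (*-nonNeg (ℕ→ℚ-nonNeg r) (inverse-nonNeg m))
                   (*-monoʳ-≤-nonNeg (inverse m) {{nonNegative (inverse-nonNeg m)}} r≤x-m))
    where
    r≤x-m : ℕ→ℚ r ≤ x - ℕ→ℚ m
    r≤x-m = subst (_≤ x - ℕ→ℚ m) (a+b-a≡b (ℕ→ℚ m) (ℕ→ℚ r))
                  (+-monoˡ-≤ (- ℕ→ℚ m) (subst (_≤ x) (ℕ→ℚ-+ m r) N≤x))

  binomPoly-nonNeg : ∀ x m → ℕ→ℚ m ≤ x + 1ℚ → 0ℚ ≤ binomPoly x m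
  binomPoly-nonNeg x zero _ = *≤* (ℤ.+≤+ ℕ.z≤n)
  binomPoly-nonNeg x (suc m) 1+m≤x+1 =
    *-nonNeg (binomPoly-nonNeg x m (≤-trans m≤x (x≤x+1 x)))
             (*-nonNeg (subst (_≤ x - ℕ→ℚ m) (+-inverseʳ (ℕ→ℚ m)) (+-monoˡ-≤ (- ℕ→ℚ m) m≤x)) (inverse-nonNeg m))
    where
    m≤x : ℕ→ℚ m ≤ x
    m≤x = subst₂ _≤_ (y+1-1≡y (ℕ→ℚ m)) (y+1-1≡y x)
      (+-monoˡ-≤ (- 1ℚ) (subst (_≤ x + 1ℚ) (trans (cong ℕ→ℚ (ℕₚ.+-comm 1 m)) (ℕ→ℚ-+ m 1)) 1+m≤x+1))
      where
      y+1-1≡y : ∀ y → (y + 1ℚ) - 1ℚ ≡ y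
      y+1-1≡y y = trans (+-assoc y 1ℚ (- 1ℚ)) (trans (cong (λ z → y + z) (+-inverseʳ 1ℚ)) (+-identityʳ y))

  binom≤binomℚ : ∀ x N m → ℕ→ℚ N ≤ x → ℕ→ℚ (binom N m) ≤ binomℚ x m
  binom≤binomℚ x N m N≤x = bound (m ℕₚ.≤? N) (ℕ→ℚ m ≤? (x + 1ℚ))
    where
    bound : Dec (m ℕ.≤ N) → (m≤x+1? : Dec (ℕ→ℚ m ≤ x + 1ℚ)) →
      ℕ→ℚ (binom N m) ≤ (if does m≤x+1? then binomPoly x m else 0ℚ)
    bound (yes m≤N) (yes _) = binom≤binomPoly x N m m≤N N≤x
    bound (yes m≤N) (no m≰x+1) = ⊥-elim (m≰x+1 (≤-trans (ℕ→ℚ-mono m≤N) (≤-trans N≤x (x≤x+1 x))))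
    bound (no m≰N) (yes m≤x+1) =
      subst (_≤ binomPoly x m) (sym (cong ℕ→ℚ (binom-zero N m (ℕₚ.≰⇒> m≰N)))) (binomPoly-nonNeg x m m≤x+1)
    bound (no m≰N) (no _) = ≤-reflexive (cong ℕ→ℚ (binom-zero N m (ℕₚ.≰⇒> m≰N)))


module Assembly where

  open import Data.Nat as ℕ using (ℕ; suc; NonZero)
  import Data.Nat.Properties as ℕₚ
  open import Data.Nat.DivMod using (_/_; m≡m%n+[m/n]*n; m%n<n; m/n*n≤m; m/n≤m; m≥n⇒m/n>0)
  open import Data.Fin using () renaming (zero to fz)
  open import Data.Rational using (ℚ; 0ℚ; _≤_; _<_; _*_; _+_; ↧ₙ_; nonNegative)
  open import Data.Rational.Properties using (≤-trans; <⇒≤; +-mono-≤; *-monoʳ-≤-nonNeg; *-distribʳ-+; *-1-commutativeMonoid; module ≤-Reasoning)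
  open import Data.Product using (Σ; _×_; _,_)
  open import Data.Sum using (_⊎_; inj₁; inj₂)
  open import Relation.Nullary using (Dec; yes; no)
  open import Relation.Binary.PropositionalEquality
  open import Algebra.Bundles using (CommutativeMonoid)
  open import Algebra.Properties.CommutativeSemigroup (CommutativeMonoid.commutativeSemigroup *-1-commutativeMonoid)
    using (xy∙z≈xz∙y)
  open import Defs hiding (sym)
  open Counting using (countV≡countF; countF≤n; size≤n)
  open Binomial using (binom; binom-zero)
  open Peeling using (indepIn≤binom)
  open CountingBound using (everything; I≤indepIn-everything; countingBound)
  open Parameters using (parameterBounds; M≤d; a≤M)
  open Rationals

  <[1+x/k]*k : ∀ x k .{{_ : NonZero k}} → x ℕ.< suc (x / k) ℕ.* k
  <[1+x/k]*k x k =
    ℕₚ.≤-trans (ℕ.s≤s (ℕₚ.≤-reflexive (m≡m%n+[m/n]*n x k))) (ℕₚ.+-monoˡ-≤ ((x / k) ℕ.* k) (m%n<n x k))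

  [1+x/k]*k≤x+k : ∀ x k .{{_ : NonZero k}} → suc (x / k) ℕ.* k ℕ.≤ x ℕ.+ k
  [1+x/k]*k≤x+k x k = ℕₚ.≤-trans (ℕₚ.≤-reflexive (ℕₚ.+-comm k ((x / k) ℕ.* k))) (ℕₚ.+-monoˡ-≤ k (m/n*n≤m x k))

  trivialBound : ∀ {n} (G : Graph n) m → n ≡ 0 ⊎ n ℕ.< m → I G m ℕ.≤ binom 0 m
  trivialBound {n} G m small =
    ℕₚ.≤-trans (I≤indepIn-everything G m) (ℕₚ.≤-trans (indepIn≤binom G n (everything n) m (size≤n (everything n))) (shrink small))
    where
    shrink : n ≡ 0 ⊎ n ℕ.< m → binom n m ℕ.≤ binom 0 m
    shrink (inj₁ refl) = ℕₚ.≤-refl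
    shrink (inj₂ n<m) = ℕₚ.≤-trans (ℕₚ.≤-reflexive (binom-zero n m n<m)) ℕ.z≤n

  degree≤n : ∀ {n d} (G : Graph n) → Regular G d → 1 ℕ.≤ n → d ℕ.≤ n
  degree≤n {suc n} G regular _ =
    ℕₚ.≤-trans (ℕₚ.≤-reflexive (trans (sym (regular fz)) (countV≡countF (adj G fz)))) (countF≤n (adj G fz))

  Density : ∀ {n} → Graph n → ℚ → ℚ → ℕ → Set
  Density {n} G ε r d = (A : VSet n) → r ≤ ℕ→ℚ (size A) → ε * ℕ→ℚ (size A) * ℕ→ℚ d ≤ ℕ→ℚ (2 ℕ.* e G A)

  densityℕ : ∀ {n} (G : Graph n) (ε r : ℚ) (b q d : ℕ) → Density G ε r d →
    (∀ k → k ℕ.≤ n → b ℕ.< k → r ≤ ℕ→ℚ k) → ℕ→ℚ q ≤ ε * ℕ→ℚ d →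
    ∀ B → b ℕ.< size B → q ℕ.* size B ℕ.≤ 2 ℕ.* e G B
  densityℕ G ε r b q d H above q≤εd B b<|B| = ℕ→ℚ-cancel (begin
    ℕ→ℚ (q ℕ.* size B)          ≡⟨ ℕ→ℚ-* q (size B) ⟩
    ℕ→ℚ q * ℕ→ℚ (size B)        ≤⟨ *-monoʳ-≤-nonNeg (ℕ→ℚ (size B)) {{nonNegative (ℕ→ℚ-nonNeg (size B))}} q≤εd ⟩
    ε * ℕ→ℚ d * ℕ→ℚ (size B)    ≡⟨ xy∙z≈xz∙y ε (ℕ→ℚ d) (ℕ→ℚ (size B)) ⟩
    ε * ℕ→ℚ (size B) * ℕ→ℚ d    ≤⟨ H B (above (size B) (size≤n B) b<|B|) ⟩
    ℕ→ℚ (2 ℕ.* e G B)           ∎)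
    where open ≤-Reasoning

  bound-nonNeg : ∀ (α δ : ℚ) n → 0ℚ ≤ α → 0ℚ ≤ δ → 0ℚ ≤ (α + δ + δ) * ℕ→ℚ n
  bound-nonNeg α δ n 0≤α 0≤δ = *-nonNeg (+-mono-≤ (+-mono-≤ 0≤α 0≤δ) 0≤δ) (ℕ→ℚ-nonNeg n)

  Cℕ : ℚ → ℚ → ℕ
  Cℕ ε δ = 1536 ℕ.* ↧ₙ ε ℕ.* ↧ₙ δ ℕ.* ↧ₙ δ

  -- The main case 1 ≤ m ≤ n: N = b + t, where b rounds (α+δ)n down,
  -- t = ⌊n/c⌋ ≤ δn, and I(G,m) ≤ C(b+t, m) by the counting bound.
  mainCase : (ε δ : ℚ) → 0ℚ < ε → 0ℚ < δ → (α : ℚ) →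
    (n d : ℕ) (G : Graph n) → Regular G d → Density G ε ((α + δ) * ℕ→ℚ n) d →
    (m : ℕ) → Cℕ ε δ ℕ.* n ℕ.≤ m ℕ.* d → 1 ℕ.≤ n → m ℕ.≤ n →
    Threshold ((α + δ) * ℕ→ℚ n) n →
    Σ ℕ λ N → (I G m ℕ.≤ binom N m) × (ℕ→ℚ N ≤ (α + δ + δ) * ℕ→ℚ n)
  mainCase ε δ 0<ε 0<δ α n d G regular H m Cn≤md 1≤n m≤n (b , b≤n , b≤r , above) =
    b ℕ.+ t , I≤C[b+t,m] (parameterBounds a c n d m q t K (ℕ.s≤s ℕ.z≤n) (ℕ.s≤s ℕ.z≤n) 1≤n Cn≤md
                             (degree≤n G regular 1≤n) m≤n (<[1+x/k]*k d a) (m/n≤m d a)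
                             ([1+x/k]*k≤x+k n (suc q)) (<[1+x/k]*k n c)) , b+t≤bound
    where
    a c q t K : ℕ
    a = ↧ₙ ε
    c = ↧ₙ δ
    q = d / a
    t = n / c
    K = suc (n / suc q)
    1≤q : 1 ℕ.≤ q
    1≤q = m≥n⇒m/n>0 (ℕₚ.≤-trans (a≤M a c (ℕ.s≤s ℕ.z≤n)) (M≤d (Cℕ ε δ) n m d 1≤n Cn≤md m≤n))
    q≤εd : ℕ→ℚ q ≤ ε * ℕ→ℚ d
    q≤εd = ≤-scale ε q a d (<⇒≤ 0<ε) (1≤ε*denominator ε 0<ε) (m/n*n≤m d a)
    t≤δn : ℕ→ℚ t ≤ δ * ℕ→ℚ n
    t≤δn = ≤-scale δ t c n (<⇒≤ 0<δ) (1≤ε*denominator δ 0<δ) (m/n*n≤m n c)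
    n≤b+K[q+1] : n ℕ.≤ b ℕ.+ K ℕ.* suc q
    n≤b+K[q+1] = ℕₚ.≤-trans (ℕₚ.<⇒≤ (<[1+x/k]*k n (suc q))) (ℕₚ.m≤n+m _ b)
    I≤C[b+t,m] : (4 ℕ.* K ℕ.≤ t) × (4 ℕ.* K ℕ.≤ m) × (64 ℕ.* n ℕ.* n ℕ.* (2 ℕ.* K) ℕ.≤ t ℕ.* t ℕ.* m) →
      I G m ℕ.≤ binom (b ℕ.+ t) m
    I≤C[b+t,m] (4K≤t , 4K≤m , 128n²K≤t²m) =
      countingBound G b q (densityℕ G ε ((α + δ) * ℕ→ℚ n) b q d H above q≤εd) 1≤q t K m
                    n≤b+K[q+1] b≤n 4K≤t 4K≤m 128n²K≤t²m
    b+t≤bound : ℕ→ℚ (b ℕ.+ t) ≤ (α + δ + δ) * ℕ→ℚ n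
    b+t≤bound = begin
      ℕ→ℚ (b ℕ.+ t)                    ≡⟨ ℕ→ℚ-+ b t ⟩
      ℕ→ℚ b + ℕ→ℚ t                    ≤⟨ +-mono-≤ b≤r t≤δn ⟩
      (α + δ) * ℕ→ℚ n + δ * ℕ→ℚ n      ≡⟨ sym (*-distribʳ-+ (ℕ→ℚ n) (α + δ) δ) ⟩
      (α + δ + δ) * ℕ→ℚ n              ∎
      where open ≤-Reasoning

  binomialWitness : (ε δ : ℚ) → 0ℚ < ε → 0ℚ < δ → (α : ℚ) → 0ℚ ≤ α →
    (n d : ℕ) (G : Graph n) → Regular G d → Density G ε ((α + δ) * ℕ→ℚ n) d →
    (m : ℕ) → ℕ→ℚ (Cℕ ε δ) * ℕ→ℚ n ≤ ℕ→ℚ m * ℕ→ℚ d →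
    Σ ℕ λ N → (I G m ℕ.≤ binom N m) × (ℕ→ℚ N ≤ (α + δ + δ) * ℕ→ℚ n)
  binomialWitness ε δ 0<ε 0<δ α 0≤α n d G regular H m Cn≤md = cases (n ℕ.≟ 0) (m ℕ.≤? n)
    where
    0≤δ : 0ℚ ≤ δ
    0≤δ = <⇒≤ 0<δ
    cases : Dec (n ≡ 0) → Dec (m ℕ.≤ n) → Σ ℕ λ N → (I G m ℕ.≤ binom N m) × (ℕ→ℚ N ≤ (α + δ + δ) * ℕ→ℚ n)
    cases (yes n≡0) _ = 0 , trivialBound G m (inj₁ n≡0) , bound-nonNeg α δ n 0≤α 0≤δ
    cases (no _) (no m≰n) = 0 , trivialBound G m (inj₂ (ℕₚ.≰⇒> m≰n)) , bound-nonNeg α δ n 0≤α 0≤δ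
    cases (no n≢0) (yes m≤n) =
      mainCase ε δ 0<ε 0<δ α n d G regular H m
        (ℕ→ℚ-cancel (subst₂ _≤_ (sym (ℕ→ℚ-* (Cℕ ε δ) n)) (sym (ℕ→ℚ-* m d)) Cn≤md)) (ℕₚ.n≢0⇒n>0 n≢0) m≤n
        (threshold ((α + δ) * ℕ→ℚ n) (*-nonNeg (+-mono-≤ 0≤α 0≤δ) (ℕ→ℚ-nonNeg n)) n)

open import Defs
open import Data.Nat using (ℕ)
open import Data.Product using (Σ; _,_)
open import Data.Rational using (ℚ; 0ℚ; _≤_; _<_; _*_; _+_)
open import Data.Rational.Properties using (≤-trans)
open Rationals using (ℕ→ℚ-mono; binom≤binomℚ)
open Assembly using (Cℕ; binomialWitness)

theorem3p3 : (ε δ : ℚ) → 0ℚ < ε → 0ℚ < δ →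
    Σ ℚ λ C →
      (α : ℚ) → 0ℚ ≤ α →
      (n d : ℕ) (G : Graph n) → Regular G d →
      ((A : VSet n) → (α + δ) * ℕ→ℚ n ≤ ℕ→ℚ (size A) →
        ε * ℕ→ℚ (size A) * ℕ→ℚ d ≤ ℕ→ℚ (2 Data.Nat.* e G A)) →
      (m : ℕ) → C * ℕ→ℚ n ≤ ℕ→ℚ m * ℕ→ℚ d →
      ℕ→ℚ (I G m) ≤ binomℚ ((α + δ + δ) * ℕ→ℚ n) m
theorem3p3 ε δ 0<ε 0<δ = ℕ→ℚ (Cℕ ε δ) , λ α 0≤α n d G regular dense m Cn≤md →
  let (N , I≤C[N,m] , N≤bound) = binomialWitness ε δ 0<ε 0<δ α 0≤α n d G regular dense m Cn≤md
  in ≤-trans (ℕ→ℚ-mono I≤C[N,m]) (binom≤binomℚ ((α + δ + δ) * ℕ→ℚ n) N m N≤bound)
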